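{- For any $m$-colored permutation $\pi$, we have $\Lambda_m(\pi) = K^{(m)}_{\widehat{C}(\pi)}$.
   Context: Fix $m\ge1$, $\omega$ a primitive $m$th root of unity. $\mathbb{P}_m$ is the set of $\omega^ji$ ($i\ge1$, $0\le j\le m-1$) ordered $1<\omega1<\cdots<\omega^{m-1}1<2<\omega2<\cdots$, color $\varepsilon(\omega^ji)=j$. An $m$-colored permutation $\pi=\pi_1\cdots\pi_n$ is a word of elements of $\mathbb{P}_m$ whose underlying integers form a permutation of $\{1,\ldots,n\}$; it is regarded as the chain $\pi_1<_\pi\pi_2<_\pi\cdots<_\pi\pi_n$. Its rainbow decomposition $\pi=\pi_{(1)}\cdots\pi_{(k)}$ splits it into maximal factors of constant color, $\pi_{(i)}$ of color $\varepsilon_i$. For a word $w=w_1\cdots w_r$ of distinct elements, its interior peak set is $\{t\in[2,r-1]:w_{t-1}<w_t>w_{t+1}\}$, and its peak composition $\widehat{C}(w)$ is the composition $(a_1,\ldots,a_s)$ of $r$ with $\{a_1,a_1+a_2,\ldots,a_1+\cdots+a_{s-1}\}$ equal to the peak set. Then $\widehat{C}(\pi)=\varepsilon_1\widehat{C}(\pi_{(1)})\cdots\varepsilon_k\widehat{C}(\pi_{(k)})$, the concatenation with each part of $\widehat{C}(\pi_{(i)})$ given color $\varepsilon_i$. $m$-colored compositions $\alpha=(\omega^{j_1}\alpha_1,\ldots)$, monomials $M^{(m)}_\alpha=\sum x_{i_1,j_1}^{\alpha_1}\cdots x_{i_k,j_k}^{\alpha_k}$ over $(i_1,j_1)<\cdots<(i_k,j_k)$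 lexicographically. Rainbow decomposition of $\alpha$: $\alpha=\alpha_{(1)}\cdots\alpha_{(r)}$ maximal equal-color blocks, colors $\epsilon_i$. For uncolored compositions refinement is generated by $(\ldots,a+b,\ldots)<(\ldots,a,b,\ldots)$ and $\beta^*$ replaces each part $\beta_i\ge2$, $i>1$, by $(1,\beta_i-1)$. $K^{(m)}_\alpha=\sum 2^{\sum_i l(\beta_{(i)})}M^{(m)}_{\epsilon_1\beta_{(1)}\cdots\epsilon_r\beta_{(r)}}$ over tuples of compositions $\beta_{(i)}$ with $|\beta_{(i)}|=|\alpha_{(i)}|$ and $\alpha_{(i)}\le\beta_{(i)}^*$ (colors forgotten), with $\epsilon_i\beta_{(i)}$ coloring all parts of $\beta_{(i)}$ by $\epsilon_i$. Colored enriched $P$-partitions: let $\mathbb{P}_m^{\pm}$ be $\mathbb{P}_m\cup(-\mathbb{P}_m)$ ordered $-1<1<-\omega1<\omega1<\cdots<-\omega^{m-1}1<\omega^{m-1}1<-2<2<\cdots$ (the sign is just a marker; $\varepsilon(\pm\omega^ji)=j$, $|\pm\omega^ji|=\omega^ji$). Write $s\le^+t$ if $s<t$ or $s=t\in\mathbb{P}_m$; $s\le^-t$ if $s<t$ or $s=t\in-\mathbb{P}_m$. For an $m$-colored poset $P$ (finite subset of $\mathbb{P}_m$ with distinct underlying integers and a partial order), an $m$-colored enriched $P$-partition is $f:P\to\mathbb{P}_m^{\pm}$ with (1) $\varepsilon(i)=\varepsilon(f(i))$, (2) $f(i)\le^+f(j)$ if $i<_Pj$ and $i<j$ in $\mathbb{P}_m$,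 (3) $f(i)\le^-f(j)$ if $i<_Pj$ and $i>j$ in $\mathbb{P}_m$. $\Lambda_m(P)=\sum_f\prod_{i\in P}x_{|f(i)|}$ with $x_{\omega^js}:=x_{s,j}$. -}

module Defs where

open import Data.Nat using (ℕ; zero; suc; _+_; _*_; _∸_; _^_; _≤_; _<_; _<ᵇ_; _≡ᵇ_)
open import Data.Nat.Properties using (_≤?_)
open import Data.Bool using (Bool; true; false; if_then_else_; _∧_)
open import Data.Fin using (Fin; toℕ)
open import Data.Fin.Properties using () renaming (_≟_ to _≟F_)
open import Data.Fin.Permutation using (Permutation′; _⟨$⟩ʳ_)
open import Data.List using (List; []; _∷_; _++_; map; concatMap; length; filter)
open import Data.Nat.ListAction using (sum)
open import Data.List.Membership.Propositional using (_∈_)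
open import Data.List.Relation.Unary.Unique.Propositional using (Unique)
open import Data.List.Relation.Unary.All using (All)
open import Data.List.Relation.Unary.Linked using (Linked)
open import Data.Vec using (Vec; tabulate; toList; lookup)
open import Data.Product using (Σ; ∃; _×_; _,_; proj₁; proj₂)
open import Data.Sum using (_⊎_)
open import Relation.Nullary using (does)
open import Relation.Binary.PropositionalEquality using (_≡_)
import Data.List.Properties as LP
import Data.Product.Properties as PP
import Data.Nat.Properties as NP

HasCard : {A : Set} → (A → Set) → ℕ → Set
HasCard {A} P k = Σ (List A) λ L →
  Unique L × (∀ a → a ∈ L → P a) × (∀ a → P a → a ∈ L) × length L ≡ k

-- Elements of ℙ_m : ω^j i is the pair (i , j)  (i ≥ 1 intended)

ℙ : ℕ → Set
ℙ m = ℕ × Fin m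

-- order 1 < ω1 < ... < ω^{m-1}1 < 2 < ... : lexicographic on (i , j)
_<ℙ_ : {m : ℕ} → ℙ m → ℙ m → Set
(i , j) <ℙ (i' , j') = i < i' ⊎ (i ≡ i' × toℕ j < toℕ j')

ltℙ : {m : ℕ} → ℙ m → ℙ m → Bool
ltℙ (i , j) (i' , j') = (i <ᵇ i') Data.Bool.∨ ((i ≡ᵇ i') ∧ (toℕ j <ᵇ toℕ j'))

-- elements of ℙ_m^± : (sign , i , j), sign true = +, false = -.
-- order: -ω^j i < ω^j i, otherwise as in ℙ_m
ℙ± : ℕ → Set
ℙ± m = Bool × ℙ m

_<±_ : {m : ℕ} → ℙ± m → ℙ± m → Set
(s , p) <± (s' , p') = p <ℙ p' ⊎ (p ≡ p' × s ≡ false × s' ≡ true)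

_≤⁺_ : {m : ℕ} → ℙ± m → ℙ± m → Set
x ≤⁺ y = x <± y ⊎ (x ≡ y × proj₁ x ≡ true)

_≤⁻_ : {m : ℕ} → ℙ± m → ℙ± m → Set
x ≤⁻ y = x <± y ⊎ (x ≡ y × proj₁ x ≡ false)

-- m-colored permutations: a permutation σ of Fin n together with colors;
-- π_k = ω^{c k} (σ k + 1)  for positions k

word : {m n : ℕ} → Permutation′ n → (Fin n → Fin m) → Vec (ℙ m) n
word σ c = tabulate λ k → (suc (toℕ (σ ⟨$⟩ʳ k)) , c k)

runs : {m : ℕ} {A : Set} → (A → Fin m) → List A → List (Fin m × List A)
runs col [] = []
runs col (x ∷ xs) with runs col xs
... | [] = (col x , x ∷ []) ∷ []
... | (c , ys) ∷ rest =
  if does (col x ≟F c) then (c , x ∷ ys) ∷ rest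
  else (col x , x ∷ []) ∷ (c , ys) ∷ rest

-- interior peak positions (1-indexed); the first argument is the index
-- of the middle letter of the current triple
peaksFrom : {m : ℕ} → ℕ → List (ℙ m) → List ℕ
peaksFrom i (a ∷ b ∷ c ∷ rest) =
  (if ltℙ a b ∧ ltℙ c b then i ∷ [] else []) ++ peaksFrom (suc i) (b ∷ c ∷ rest)
peaksFrom i _ = []

peakSet : {m : ℕ} → List (ℙ m) → List ℕ
peakSet w = peaksFrom 2 w

diffs : ℕ → List ℕ → List ℕ
diffs prev [] = []
diffs prev (p ∷ ps) = (p ∸ prev) ∷ diffs p ps

peakComp : {m : ℕ} → List (ℙ m) → List ℕ
peakComp w = diffs 0 (peakSet w ++ (length w ∷ []))

CComp : ℕ → Set
CComp m = List (Fin m × ℕ)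

colorParts : {m : ℕ} → Fin m → List ℕ → CComp m
colorParts e β = map (λ a → (e , a)) β

Chat : {m n : ℕ} → Vec (ℙ m) n → CComp m
Chat π = concatMap (λ b → colorParts (proj₁ b) (peakComp (proj₂ b)))
                   (runs proj₂ (toList π))

-- monomials: lists (i , j , e) meaning ∏ x_{i,j}^e

Monomial : ℕ → Set
Monomial m = List (ℕ × Fin m × ℕ)

varOf : {m : ℕ} → ℕ × Fin m × ℕ → ℙ m
varOf (i , j , e) = (i , j)

Canonical : {m : ℕ} → Monomial m → Set
Canonical μ = All (λ t → 1 ≤ proj₁ t × 1 ≤ proj₂ (proj₂ t)) μ
            × Linked (λ s t → varOf s <ℙ varOf t) μ

expo : {m : ℕ} → Monomial m → ℕ → Fin m → ℕ
expo μ i j = sum (map (λ t → if (proj₁ t ≡ᵇ i) ∧ does (proj₁ (proj₂ t) ≟F j)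
                             then proj₂ (proj₂ t) else 0) μ)

typeOf : {m : ℕ} → Monomial m → CComp m
typeOf μ = map (λ t → (proj₁ (proj₂ t) , proj₂ (proj₂ t))) μ

-- coefficient of μ in M^{(m)}_γ
Mcoef : {m : ℕ} → CComp m → Monomial m → ℕ
Mcoef γ μ = if does (LP.≡-dec (PP.≡-dec _≟F_ NP._≟_) (typeOf μ) γ) then 1 else 0

-- all compositions of n (first part a ∈ [1,n], then a composition of n - a);
-- the first argument is fuel (we call it with fuel n)
range1 : ℕ → List ℕ
range1 zero = []
range1 (suc n) = range1 n ++ (suc n ∷ [])

compsF : ℕ → ℕ → List (List ℕ)
compsF _ zero = [] ∷ []
compsF zero (suc n) = []
compsF (suc f) n = concatMap (λ a → map (a ∷_) (compsF f (n ∸ a))) (range1 n)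

comps : ℕ → List (List ℕ)
comps n = compsF n n

splitPart : ℕ → List ℕ
splitPart (suc (suc k)) = 1 ∷ suc k ∷ []
splitPart b = b ∷ []

star : List ℕ → List ℕ
star [] = []
star (b ∷ bs) = b ∷ concatMap splitPart bs

-- refinement order: α ≤ β iff β is obtained from α by splitting parts,
-- i.e. each part of α is the sum of a consecutive block of parts of β
mutual
  refines : List ℕ → List ℕ → Bool      -- refines α β  ⇔  α ≤ β
  refines [] [] = true
  refines [] (_ ∷ _) = false
  refines (a ∷ as) fine = eat a as fine

  eat : ℕ → List ℕ → List ℕ → Bool
  eat r as [] = false
  eat r as (b ∷ bs) =
    if b <ᵇ r then eat (r ∸ b) as bs
    else if b ≡ᵇ r then refines as bs
    else false

sequenceL : {A : Set} → List (List A) → List (List A)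
sequenceL [] = [] ∷ []
sequenceL (xs ∷ xss) = concatMap (λ x → map (x ∷_) (sequenceL xss)) xs

candidates : {m : ℕ} → Fin m × CComp m → List (Fin m × List ℕ)
candidates (ε , a) =
  let a' = map proj₂ a in
  map (λ β → (ε , β)) (filter (λ β → Data.Bool._≟_ (refines a' (star β)) true) (comps (sum a')))

-- coefficient of μ in K^{(m)}_α
--   = Σ_{(β₍₁₎,…,β₍ᵣ₎)} 2^{Σ l(β₍ᵢ₎)} · [μ in M_{ε₁β₍₁₎⋯ε_rβ₍ᵣ₎}]
Kcoef : {m : ℕ} → CComp m → Monomial m → ℕ
Kcoef α μ = sum (map term (sequenceL (map candidates (runs proj₁ α))))
  where
  term : _ → ℕ
  term t = 2 ^ sum (map (λ b → length (proj₂ b)) t)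
           * Mcoef (concatMap (λ b → colorParts (proj₁ b) (proj₂ b)) t) μ

-- colored enriched P-partitions of the chain π₁ <_π ⋯ <_π πₙ.
-- f is recorded as the vector of values f(π_k), k = position.

IsEnriched : {m n : ℕ} → Vec (ℙ m) n → Vec (ℙ± m) n → Set
IsEnriched {m} {n} π f =
    (∀ k → 1 ≤ proj₁ (proj₂ (lookup f k)))
  × (∀ k → proj₂ (proj₂ (lookup f k)) ≡ proj₂ (lookup π k))
  × (∀ (a b : Fin n) → toℕ a < toℕ b →
       lookup π a <ℙ lookup π b → lookup f a ≤⁺ lookup f b)
  × (∀ (a b : Fin n) → toℕ a < toℕ b →
       lookup π b <ℙ lookup π a → lookup f a ≤⁻ lookup f b)

WeightIs : {m n : ℕ} → Vec (ℙ± m) n → Monomial m → Set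
WeightIs {m} f μ = ∀ (i : ℕ) (j : Fin m) → countVar i j ≡ expo μ i j
  where
  countVar : ℕ → Fin m → ℕ
  countVar i j = sum (map (λ x → if (proj₁ (proj₂ x) ≡ᵇ i) ∧ does (proj₂ (proj₂ x) ≟F j)
                                  then 1 else 0) (toList f))

-- An enriched partition f of the chain π has |f| weakly increasing along π, so the
-- sequence of its absolute values is the sorted expansion of μ and only the signs are
-- free. The constraints on the signs are local: where two consecutive positions carry
-- the same value, an ascent of π forces the later sign to be + and a descent forces the
-- earlier one to be −. The count is therefore a product over positions, and grouping the
-- positions into the blocks of equal value, a block contributes 2 if its letters have the
-- colour of its variable and it has no interior peak, and 0 otherwise.
--
-- In K_{Ĉ(π)} the monomial μ can only come from the term whose i-th part is the list of
-- exponents of the factors of μ lying over the i-th colour run of π, so these must cover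
-- the runs exactly. The refinement condition Ĉ(π₍ᵢ₎) ≤ β₍ᵢ₎* says that every peak of the
-- run lies at a cut of β₍ᵢ₎ or just after one, i.e. that no block has an interior peak,
-- and the weight 2^{l(β₍ᵢ₎)} supplies the factor 2 per block.

module Submission where

open import Defs
open import Data.Bool using (Bool; true; false; if_then_else_; _∧_; not)
import Data.Bool as Bool
open import Data.Empty using (⊥; ⊥-elim)
open import Data.Fin using (Fin; toℕ; fromℕ<) renaming (zero to fzero; suc to fsuc)
import Data.Fin.Properties as Fin
open import Data.Fin.Permutation using (Permutation′; _⟨$⟩ʳ_; _⟨$⟩ˡ_; inverseˡ)
open import Data.List using (List; []; _∷_; _++_; map; concatMap; length; replicate; take; drop; head; null; zip; filter)
open import Data.List.Properties
  using (length-++; length-map; length-take; length-drop; length-replicate; map-∘; map-id-local; map-++; map-cong;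
         take-map; drop-map; take-all; drop-all; take++drop≡id; ++-identityʳ; ∷-injective)
import Data.List.Properties as List
open import Data.List.Membership.Propositional using (_∈_; _∉_)
open import Data.List.Membership.Propositional.Properties using (∈-map⁺; ∈-map⁻; ∈-++⁺ˡ; ∈-++⁺ʳ; ∈-++⁻)
open import Data.List.Relation.Binary.Pointwise using (Pointwise; []; _∷_; Pointwise-length)
open import Data.List.Relation.Unary.All using (All; []; _∷_)
import Data.List.Relation.Unary.All as All
import Data.List.Relation.Unary.All.Properties as All
open import Data.List.Relation.Unary.AllPairs using (AllPairs; []; _∷_)
import Data.List.Relation.Unary.AllPairs as AllPairs
import Data.List.Relation.Unary.AllPairs.Properties as AllPairs
open import Data.List.Relation.Unary.Any using (here; there)
open import Data.List.Relation.Unary.Linked using (Linked; []; [-]; _∷_)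
import Data.List.Relation.Unary.Linked as Linked
open import Data.List.Relation.Unary.Linked.Properties using (AllPairs⇒Linked)
open import Data.List.Relation.Unary.Unique.Propositional using (Unique)
import Data.List.Relation.Unary.Unique.Propositional.Properties as Unique
open import Data.Maybe using (Maybe; just; nothing; maybe′)
import Data.Maybe as Maybe
open import Data.Maybe.Properties using (just-injective)
open import Data.Nat using (ℕ; zero; suc; _+_; _*_; _∸_; _^_; _≤_; _<_; _≤ᵇ_; _≡ᵇ_; z≤n; s≤s)
import Data.Nat.Properties as ℕ
open import Data.Nat.ListAction using (sum; product)
open import Data.Nat.ListAction.Properties using (sum-++; product-++)
open import Data.Nat.Tactic.RingSolver using (solve-∀)
open import Data.Product using (∃; _×_; _,_; proj₁; proj₂)
import Data.Product.Properties as Product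
open import Data.Product.Relation.Binary.Lex.Strict using (×-isStrictTotalOrder; ×-decidable)
open import Data.Product.Relation.Binary.Pointwise.NonDependent using (≡×≡⇒≡; ≡⇒≡×≡)
import Data.Product.Relation.Binary.Pointwise.NonDependent as ×
open import Data.Sum using (_⊎_; inj₁; inj₂)
open import Data.Unit using (⊤; tt)
open import Data.Vec using (Vec; []; _∷_; lookup; toList)
import Data.Vec as Vec
open import Data.Vec.Properties using (toList-injective; cast-is-id; length-toList; lookup-zip; lookup∘tabulate)
open import Function using (_∘′_)
open import Relation.Binary.Definitions using (Decidable; DecidableEquality; Transitive; Asymmetric; tri<; tri≈; tri>)
open import Relation.Binary.PropositionalEquality
open import Relation.Binary.Structures using (IsStrictTotalOrder)
open import Relation.Nullary using (¬_; Dec; does; yes; no)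
open import Relation.Nullary.Decidable using (map′; _×-dec_; dec-true; dec-false; does-≡)
import Relation.Unary as U

open ≡-Reasoning

-- Counting choices

module _ {A : Set} where

  ∈-sequenceL⁻ : ∀ (O : List (List A)) {l} → l ∈ sequenceL O → Pointwise _∈_ l O
  ∈-sequenceL⁻ [] (here refl) = []
  ∈-sequenceL⁻ (xs ∷ O) = choose xs
    where
    choose : ∀ ys {l} → l ∈ concatMap (λ y → map (y ∷_) (sequenceL O)) ys → Pointwise _∈_ l (ys ∷ O)
    choose (y ∷ ys) l∈ with ∈-++⁻ (map (y ∷_) (sequenceL O)) l∈
    ... | inj₂ later with choose ys later
    ...   | y∈ ∷ rest = there y∈ ∷ rest
    choose (y ∷ ys) l∈ | inj₁ now with ∈-map⁻ (y ∷_) now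
    ...   | t , t∈ , refl = here refl ∷ ∈-sequenceL⁻ O t∈

  ∈-sequenceL⁺ : ∀ (O : List (List A)) {l} → Pointwise _∈_ l O → l ∈ sequenceL O
  ∈-sequenceL⁺ [] [] = here refl
  ∈-sequenceL⁺ (xs ∷ O) {x ∷ l} (x∈ ∷ l∈) = choose xs x∈
    where
    choose : ∀ ys → x ∈ ys → (x ∷ l) ∈ concatMap (λ y → map (y ∷_) (sequenceL O)) ys
    choose (y ∷ ys) (here refl) = ∈-++⁺ˡ (∈-map⁺ (x ∷_) (∈-sequenceL⁺ O l∈))
    choose (y ∷ ys) (there x∈ys) = ∈-++⁺ʳ (map (y ∷_) (sequenceL O)) (choose ys x∈ys)

  sequenceL-unique : ∀ (O : List (List A)) → All Unique O → Unique (sequenceL O)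
  sequenceL-unique [] [] = [] ∷ []
  sequenceL-unique (xs ∷ O) (uxs ∷ uO) = choices xs uxs
    where
    choices : ∀ ys → Unique ys → Unique (concatMap (λ y → map (y ∷_) (sequenceL O)) ys)
    choices [] [] = []
    choices (y ∷ ys) (y∉ys ∷ uys) =
      Unique.++⁺ (Unique.map⁺ (λ { refl → refl }) (sequenceL-unique O uO)) (choices ys uys) disjoint
      where
      disjoint : ∀ {v} → ¬ (v ∈ map (y ∷_) (sequenceL O) × v ∈ concatMap (λ y → map (y ∷_) (sequenceL O)) ys)
      disjoint (now , later) with ∈-map⁻ (y ∷_) now
      ... | _ , _ , refl with ∈-sequenceL⁻ (ys ∷ O) later
      ...   | y∈ys ∷ _ = All.lookup y∉ys y∈ys refl

  length-sequenceL : ∀ (O : List (List A)) → length (sequenceL O) ≡ product (map length O)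
  length-sequenceL [] = refl
  length-sequenceL (xs ∷ O) = choices xs
    where
    choices : ∀ ys → length (concatMap (λ y → map (y ∷_) (sequenceL O)) ys) ≡ length ys * product (map length O)
    choices [] = refl
    choices (y ∷ ys) = trans (length-++ (map (y ∷_) (sequenceL O)))
                             (cong₂ _+_ (trans (length-map (y ∷_) (sequenceL O)) (length-sequenceL O)) (choices ys))

  hasCard-choices : ∀ (O : List (List A)) → All Unique O →
                    HasCard (λ l → Pointwise _∈_ l O) (product (map length O))
  hasCard-choices O uO = sequenceL O , sequenceL-unique O uO , (λ _ → ∈-sequenceL⁻ O)
                       , (λ _ → ∈-sequenceL⁺ O) , length-sequenceL O

hasCard-retract : {A B : Set} {P : A → Set} {Q : B → Set} {k : ℕ}
  (t : A → B) (s : B → A) → (∀ b → Q b → t (s b) ≡ b) → (∀ {a a′} → t a ≡ t a′ → a ≡ a′) →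
  (∀ a → P a → Q (t a)) → (∀ a → Q (t a) → P a) → HasCard Q k → HasCard P k
hasCard-retract {P = P} {Q} t s ts t-inj PQ QP (L , uL , sound , complete , len) =
  map s L , Unique.map⁻ {f = t} (subst Unique (sym t∘s≡id) uL) , sound′ , complete′ , trans (length-map s L) len
  where
  t∘s≡id : map t (map s L) ≡ L
  t∘s≡id = trans (sym (map-∘ L)) (map-id-local (All.tabulate (λ {b} b∈ → ts b (sound b b∈))))
  sound′ : ∀ a → a ∈ map s L → P a
  sound′ a a∈ with ∈-map⁻ s a∈
  ... | b , b∈ , refl = QP (s b) (subst Q (sym (ts b (sound b b∈))) (sound b b∈))
  complete′ : ∀ a → P a → a ∈ map s L
  complete′ a pa = subst (_∈ map s L) (t-inj (ts (t a) (PQ a pa))) (∈-map⁺ s (complete (t a) (PQ a pa)))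

module _ {A B : Set} where

  AllPairs-zip⁺ : ∀ {R : A → A → Set} {w : List A} (ℓ : List B) → AllPairs R w → AllPairs (λ c d → R (proj₁ c) (proj₁ d)) (zip w ℓ)
  AllPairs-zip⁺ ℓ [] = []
  AllPairs-zip⁺ [] (_ ∷ _) = []
  AllPairs-zip⁺ {R} (y ∷ ℓ) (_∷_ {x} {w} x∼w rest) = heads w ℓ x∼w ∷ AllPairs-zip⁺ ℓ rest
    where
    heads : ∀ w ℓ → All (R x) w → All (λ d → R x (proj₁ d)) (zip w ℓ)
    heads [] _ _ = []
    heads (_ ∷ _) [] _ = []
    heads (_ ∷ w) (_ ∷ ℓ) (x∼z ∷ x∼w) = x∼z ∷ heads w ℓ x∼w

  map-proj₂-zip : ∀ {S : A → B → Set} {w ℓ} → Pointwise S w ℓ → map proj₂ (zip w ℓ) ≡ ℓ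
  map-proj₂-zip [] = refl
  map-proj₂-zip (_ ∷ rest) = cong (_ ∷_) (map-proj₂-zip rest)

-- Enriched chains as sign choices

false≢true : false ≢ true
false≢true ()

module _ {m : ℕ} where

  <ℙ-isStrictTotalOrder : IsStrictTotalOrder (×.Pointwise _≡_ _≡_) (_<ℙ_ {m})
  <ℙ-isStrictTotalOrder = ×-isStrictTotalOrder ℕ.<-isStrictTotalOrder Fin.<-isStrictTotalOrder

  <ℙ-trans : Transitive (_<ℙ_ {m})
  <ℙ-trans = IsStrictTotalOrder.trans <ℙ-isStrictTotalOrder

  <ℙ-asym : Asymmetric (_<ℙ_ {m})
  <ℙ-asym = IsStrictTotalOrder.asym <ℙ-isStrictTotalOrder

  <ℙ-irrefl : {p : ℙ m} → ¬ p <ℙ p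
  <ℙ-irrefl = IsStrictTotalOrder.irrefl <ℙ-isStrictTotalOrder (refl , refl)

  ≢⇒<ℙ⊎>ℙ : {p q : ℙ m} → p ≢ q → p <ℙ q ⊎ q <ℙ p
  ≢⇒<ℙ⊎>ℙ {p} {q} p≢q with IsStrictTotalOrder.compare <ℙ-isStrictTotalOrder p q
  ... | tri< p<q _ _ = inj₁ p<q
  ... | tri≈ _ p≈q _ = ⊥-elim (p≢q (≡×≡⇒≡ p≈q))
  ... | tri> _ _ q<p = inj₂ q<p

  -- Chosen so that ltℙ and the tests in expo and WeightIs are definitionally does of these.
  _<ℙ?_ : Decidable (_<ℙ_ {m})
  _<ℙ?_ = ×-decidable ℕ._≟_ ℕ._<?_ Fin._<?_

  _≟ℙ_ : DecidableEquality (ℙ m)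
  p ≟ℙ q = map′ ≡×≡⇒≡ ≡⇒≡×≡ (proj₁ p ℕ.≟ proj₁ q ×-dec proj₂ p Fin.≟ proj₂ q)

  _≤ℙ_ : ℙ m → ℙ m → Set
  p ≤ℙ q = p <ℙ q ⊎ p ≡ q

  <-≤ℙ-trans : {p q r : ℙ m} → p <ℙ q → q ≤ℙ r → p <ℙ r
  <-≤ℙ-trans p<q (inj₁ q<r) = <ℙ-trans p<q q<r
  <-≤ℙ-trans p<q (inj₂ refl) = p<q

  ≤ℙ-antisym : {p q : ℙ m} → p ≤ℙ q → q ≤ℙ p → p ≡ q
  ≤ℙ-antisym (inj₂ p≡q) _ = p≡q
  ≤ℙ-antisym (inj₁ _) (inj₂ q≡p) = sym q≡p
  ≤ℙ-antisym (inj₁ p<q) (inj₁ q<p) = ⊥-elim (<ℙ-asym p<q q<p)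

  ∣_∣ : ℙ± m → ℙ m
  ∣ x ∣ = proj₂ x

  sign : ℙ± m → Bool
  sign = proj₁

  -- The conditions f(i) ∈ ℙ_m^± and (1) of an enriched P-partition, for a letter of colour c.
  Fits : ℙ m → Fin m → Set
  Fits v c = 1 ≤ proj₁ v × proj₂ v ≡ c

  fits? : (v : ℙ m) (c : Fin m) → Dec (Fits v c)
  fits? v c = 1 ℕ.≤? proj₁ v ×-dec proj₂ v Fin.≟ c

  Admissible : ℙ m → ℙ m → Set
  Admissible p e = Fits e (proj₂ p)

  admissible? : (p e : ℙ m) → Dec (Admissible p e)
  admissible? p e = fits? e (proj₂ p)

  ChainCompatible : ℙ m × ℙ± m → ℙ m × ℙ± m → Set
  ChainCompatible (p , x) (q , y) = (p <ℙ q → x ≤⁺ y) × (q <ℙ p → x ≤⁻ y)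

  -- A neighbouring position, recorded as (letter , value).
  Neighbour : Set
  Neighbour = Maybe (ℙ m × ℙ m)

  -- The neighbour carries the same value e and a smaller letter. A tie with the previous
  -- position forces the sign at p to be +, a tie with the next one forces it to be −.
  Tie : Neighbour → ℙ m → ℙ m → Set
  Tie nothing p e = ⊥
  Tie (just (q , e′)) p e = e′ ≡ e × q <ℙ p

  tie? : (nb : Neighbour) (p e : ℙ m) → Dec (Tie nb p e)
  tie? nothing p e = no λ ()
  tie? (just (q , e′)) p e = e′ ≟ℙ e ×-dec q <ℙ? p

  PlusForced MinusForced : Neighbour → ℙ m → ℙ± m → Set
  PlusForced nb p x = Tie nb p ∣ x ∣ → sign x ≡ true
  MinusForced nb p x = Tie nb p ∣ x ∣ → sign x ≡ false

  AdjacentCompatible : ℙ m × ℙ± m → ℙ m × ℙ± m → Set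
  AdjacentCompatible (p , x) (q , y) = PlusForced (just (p , ∣ x ∣)) q y × MinusForced (just (q , ∣ y ∣)) p x

  minusOption plusOption : Neighbour → ℙ m → ℙ m → List (ℙ± m)
  minusOption prev p e with tie? prev p e
  ... | yes _ = []
  ... | no _ = (false , e) ∷ []
  plusOption next p e with tie? next p e
  ... | yes _ = []
  ... | no _ = (true , e) ∷ []

  signOptions : Neighbour → ℙ m → ℙ m → Neighbour → List (ℙ± m)
  signOptions prev p e next with admissible? p e
  ... | yes _ = minusOption prev p e ++ plusOption next p e
  ... | no _ = []

  nextNeighbour : List (ℙ m) → List (ℙ m) → Neighbour
  nextNeighbour (q ∷ _) (e ∷ _) = just (q , e)
  nextNeighbour _ _ = nothing

  optionLists : Neighbour → List (ℙ m) → List (ℙ m) → List (List (ℙ± m))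
  optionLists prev [] [] = []
  optionLists prev [] (_ ∷ _) = [] ∷ []
  optionLists prev (_ ∷ _) [] = [] ∷ []
  optionLists prev (p ∷ w) (e ∷ E) = signOptions prev p e (nextNeighbour w E) ∷ optionLists (just (p , e)) w E

  optionCount : Neighbour → List (ℙ m) → List (ℙ m) → ℕ
  optionCount prev w E = product (map length (optionLists prev w E))

  ∈-minusOption⁻ : ∀ {prev p e x} → x ∈ minusOption prev p e → x ≡ (false , e) × ¬ Tie prev p e
  ∈-minusOption⁻ {prev} {p} {e} x∈ with tie? prev p e
  ∈-minusOption⁻ (here refl) | no ¬tie = refl , ¬tie

  ∈-plusOption⁻ : ∀ {next p e x} → x ∈ plusOption next p e → x ≡ (true , e) × ¬ Tie next p e
  ∈-plusOption⁻ {next} {p} {e} x∈ with tie? next p e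
  ∈-plusOption⁻ (here refl) | no ¬tie = refl , ¬tie

  ∈-minusOption⁺ : ∀ {prev p e} → ¬ Tie prev p e → (false , e) ∈ minusOption prev p e
  ∈-minusOption⁺ {prev} {p} {e} ¬tie with tie? prev p e
  ... | yes tie = ⊥-elim (¬tie tie)
  ... | no _ = here refl

  ∈-plusOption⁺ : ∀ {next p e} → ¬ Tie next p e → (true , e) ∈ plusOption next p e
  ∈-plusOption⁺ {next} {p} {e} ¬tie with tie? next p e
  ... | yes tie = ⊥-elim (¬tie tie)
  ... | no _ = here refl

  ∈-signOptions⁻ : ∀ {prev p e next x} → x ∈ signOptions prev p e next →
                   ∣ x ∣ ≡ e × Admissible p e × PlusForced prev p x × MinusForced next p x
  ∈-signOptions⁻ {prev} {p} {e} {next} x∈ with admissible? p e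
  ... | yes ok with ∈-++⁻ (minusOption prev p e) x∈
  ...   | inj₁ x∈⁻ with ∈-minusOption⁻ x∈⁻
  ...     | refl , ¬tie = refl , ok , ⊥-elim ∘′ ¬tie , λ _ → refl
  ∈-signOptions⁻ {prev} {p} {e} {next} x∈ | yes ok | inj₂ x∈⁺ with ∈-plusOption⁻ x∈⁺
  ...     | refl , ¬tie = refl , ok , (λ _ → refl) , ⊥-elim ∘′ ¬tie

  ∈-signOptions⁺ : ∀ {prev p e next x} → ∣ x ∣ ≡ e → Admissible p e → PlusForced prev p x → MinusForced next p x →
                   x ∈ signOptions prev p e next
  ∈-signOptions⁺ {prev} {p} {e} {next} {s , .e} refl ok plus minus with admissible? p e
  ... | no ¬ok = ⊥-elim (¬ok ok)
  ∈-signOptions⁺ {x = false , _} refl ok plus minus | yes _ =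
    ∈-++⁺ˡ (∈-minusOption⁺ λ tie → false≢true (plus tie))
  ∈-signOptions⁺ {prev} {p} {e} {x = true , _} refl ok plus minus | yes _ =
    ∈-++⁺ʳ (minusOption prev p e) (∈-plusOption⁺ λ tie → false≢true (sym (minus tie)))

  AdmissibleAt : ℙ m → ℙ± m → Set
  AdmissibleAt p x = Admissible p ∣ x ∣

  HeadPlusForced : Neighbour → List (ℙ m) → List (ℙ± m) → Set
  HeadPlusForced prev (p ∷ _) (x ∷ _) = PlusForced prev p x
  HeadPlusForced prev _ _ = ⊤

  LocallyValid : Neighbour → List (ℙ m) → List (ℙ m) → List (ℙ± m) → Set
  LocallyValid prev w E ℓ = map ∣_∣ ℓ ≡ E × Pointwise AdmissibleAt w ℓ
                          × Linked AdjacentCompatible (zip w ℓ) × HeadPlusForced prev w ℓ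

  private
    headMinusForced : ∀ p x w ℓ → Linked AdjacentCompatible ((p , x) ∷ zip w ℓ) →
                      MinusForced (nextNeighbour w (map ∣_∣ ℓ)) p x
    headMinusForced p x [] ℓ _ ()
    headMinusForced p x (_ ∷ _) [] _ ()
    headMinusForced p x (_ ∷ _) (_ ∷ _) ((_ , minus) ∷ _) = minus

    headPlusForced : ∀ p x w ℓ → Linked AdjacentCompatible ((p , x) ∷ zip w ℓ) →
                     HeadPlusForced (just (p , ∣ x ∣)) w ℓ
    headPlusForced p x [] ℓ _ = tt
    headPlusForced p x (_ ∷ _) [] _ = tt
    headPlusForced p x (_ ∷ _) (_ ∷ _) ((plus , _) ∷ _) = plus

    adjacentCompatible-cons : ∀ p x w ℓ → HeadPlusForced (just (p , ∣ x ∣)) w ℓ →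
                              MinusForced (nextNeighbour w (map ∣_∣ ℓ)) p x →
                              Linked AdjacentCompatible (zip w ℓ) →
                              Linked AdjacentCompatible ((p , x) ∷ zip w ℓ)
    adjacentCompatible-cons p x [] ℓ _ _ _ = [-]
    adjacentCompatible-cons p x (_ ∷ _) [] _ _ _ = [-]
    adjacentCompatible-cons p x (_ ∷ _) (_ ∷ _) plus minus linked = (plus , minus) ∷ linked

  ∈-optionLists⁻ : ∀ prev w {E ℓ} → Pointwise _∈_ ℓ (optionLists prev w E) → LocallyValid prev w E ℓ
  ∈-optionLists⁻ prev [] {[]} [] = refl , [] , [] , tt
  ∈-optionLists⁻ prev [] {_ ∷ _} (() ∷ _)
  ∈-optionLists⁻ prev (p ∷ w) {[]} (() ∷ _)
  ∈-optionLists⁻ prev (p ∷ w) {e ∷ E} {x ∷ ℓ} (x∈ ∷ ℓ∈)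
    with ∈-signOptions⁻ {prev} {p} {e} {nextNeighbour w E} x∈ | ∈-optionLists⁻ (just (p , e)) w ℓ∈
  ... | refl , ok , plus , minus | refl , admissible , linked , head =
    refl , ok ∷ admissible , adjacentCompatible-cons p x w ℓ head minus linked , plus

  ∈-optionLists⁺ : ∀ prev w {E ℓ} → LocallyValid prev w E ℓ → Pointwise _∈_ ℓ (optionLists prev w E)
  ∈-optionLists⁺ prev [] {ℓ = []} (refl , [] , _ , _) = []
  ∈-optionLists⁺ prev (p ∷ w) {ℓ = x ∷ ℓ} (refl , ok ∷ admissible , linked , plus) =
    ∈-signOptions⁺ refl ok plus (headMinusForced p x w ℓ linked)
    ∷ ∈-optionLists⁺ (just (p , ∣ x ∣)) w (refl , admissible , Linked.tail linked , headPlusForced p x w ℓ linked)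

  signOptions-unique : ∀ prev p e next → Unique (signOptions prev p e next)
  signOptions-unique prev p e next with admissible? p e
  ... | no _ = []
  ... | yes _ = Unique.++⁺ minusOption-unique plusOption-unique disjoint
    where
    minusOption-unique : Unique (minusOption prev p e)
    minusOption-unique with tie? prev p e
    ... | yes _ = []
    ... | no _ = [] ∷ []
    plusOption-unique : Unique (plusOption next p e)
    plusOption-unique with tie? next p e
    ... | yes _ = []
    ... | no _ = [] ∷ []
    disjoint : ∀ {x} → ¬ (x ∈ minusOption prev p e × x ∈ plusOption next p e)
    disjoint (x∈⁻ , x∈⁺) with ∈-minusOption⁻ x∈⁻ | ∈-plusOption⁻ x∈⁺
    ... | refl , _ | () , _

  optionLists-unique : ∀ prev w E → All Unique (optionLists prev w E)
  optionLists-unique prev [] [] = []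
  optionLists-unique prev [] (_ ∷ _) = [] ∷ []
  optionLists-unique prev (_ ∷ _) [] = [] ∷ []
  optionLists-unique prev (p ∷ w) (e ∷ E) =
    signOptions-unique prev p e (nextNeighbour w E) ∷ optionLists-unique (just (p , e)) w E

  private
    ≤±⇒≤ℙ : ∀ {x y : ℙ± m} {P : Set} → x <± y ⊎ (x ≡ y × P) → ∣ x ∣ ≤ℙ ∣ y ∣
    ≤±⇒≤ℙ (inj₁ (inj₁ lt)) = inj₁ lt
    ≤±⇒≤ℙ (inj₁ (inj₂ (eq , _))) = inj₂ eq
    ≤±⇒≤ℙ (inj₂ (refl , _)) = inj₂ refl

    ≤⁺⇒plus : ∀ {x y : ℙ± m} → x ≤⁺ y → ∣ x ∣ ≡ ∣ y ∣ → sign y ≡ true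
    ≤⁺⇒plus (inj₁ (inj₁ lt)) eq = ⊥-elim (<ℙ-irrefl (subst (_<ℙ _) eq lt))
    ≤⁺⇒plus (inj₁ (inj₂ (_ , _ , plus))) _ = plus
    ≤⁺⇒plus (inj₂ (refl , plus)) _ = plus

    ≤⁻⇒minus : ∀ {x y : ℙ± m} → x ≤⁻ y → ∣ x ∣ ≡ ∣ y ∣ → sign x ≡ false
    ≤⁻⇒minus (inj₁ (inj₁ lt)) eq = ⊥-elim (<ℙ-irrefl (subst (_<ℙ _) eq lt))
    ≤⁻⇒minus (inj₁ (inj₂ (_ , minus , _))) _ = minus
    ≤⁻⇒minus (inj₂ (refl , minus)) _ = minus

    plus⇒≤⁺ : ∀ (x y : ℙ± m) → ∣ x ∣ ≡ ∣ y ∣ → sign y ≡ true → x ≤⁺ y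
    plus⇒≤⁺ (false , v) (.true , .v) refl refl = inj₁ (inj₂ (refl , refl , refl))
    plus⇒≤⁺ (true , v) (.true , .v) refl refl = inj₂ (refl , refl)

    minus⇒≤⁻ : ∀ (x y : ℙ± m) → ∣ x ∣ ≡ ∣ y ∣ → sign x ≡ false → x ≤⁻ y
    minus⇒≤⁻ (.false , v) (true , .v) refl refl = inj₁ (inj₂ (refl , refl , refl))
    minus⇒≤⁻ (.false , v) (false , .v) refl refl = inj₂ (refl , refl)

  chainCompatible⇒adjacent : ∀ {a b} → ChainCompatible a b → AdjacentCompatible a b
  chainCompatible⇒adjacent (plus , minus) =
    (λ (eq , lt) → ≤⁺⇒plus (plus lt) eq) , (λ (eq , lt) → ≤⁻⇒minus (minus lt) (sym eq))

  chainCompatible⇒≤ℙ : ∀ {p q x y} → ChainCompatible (p , x) (q , y) → p ≢ q → ∣ x ∣ ≤ℙ ∣ y ∣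
  chainCompatible⇒≤ℙ (plus , minus) p≢q with ≢⇒<ℙ⊎>ℙ p≢q
  ... | inj₁ p<q = ≤±⇒≤ℙ (plus p<q)
  ... | inj₂ q<p = ≤±⇒≤ℙ (minus q<p)

  -- Along a run of equal values the adjacent constraints propagate: this is the
  -- invariant carried from a position to all later ones.
  ChainInvariant : ℙ m × ℙ± m → ℙ m × ℙ± m → Set
  ChainInvariant (p , x) (q , y) = ∣ x ∣ <ℙ ∣ y ∣
    ⊎ (∣ x ∣ ≡ ∣ y ∣ × (p <ℙ q → sign y ≡ true) × (q <ℙ p → sign x ≡ false))

  private
    invariant⇒chainCompatible : ∀ a b → ChainInvariant a b → ChainCompatible a b
    invariant⇒chainCompatible _ _ (inj₁ lt) = (λ _ → inj₁ (inj₁ lt)) , (λ _ → inj₁ (inj₁ lt))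
    invariant⇒chainCompatible (p , x) (q , y) (inj₂ (eq , plus , minus)) =
      (λ lt → plus⇒≤⁺ x y eq (plus lt)) , (λ lt → minus⇒≤⁻ x y eq (minus lt))

    adjacent⇒invariant : ∀ {p x q y} → AdjacentCompatible (p , x) (q , y) → ∣ x ∣ ≤ℙ ∣ y ∣ → ChainInvariant (p , x) (q , y)
    adjacent⇒invariant _ (inj₁ lt) = inj₁ lt
    adjacent⇒invariant (plus , minus) (inj₂ eq) = inj₂ (eq , (λ lt → plus (eq , lt)) , (λ lt → minus (sym eq , lt)))

    invariant-step : ∀ {p x q y r z} → ChainInvariant (p , x) (q , y) → AdjacentCompatible (q , y) (r , z) →
                     ∣ y ∣ ≤ℙ ∣ z ∣ → p ≢ q → q ≢ r → ChainInvariant (p , x) (r , z)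
    invariant-step (inj₁ lt) _ y≤z _ _ = inj₁ (<-≤ℙ-trans lt y≤z)
    invariant-step (inj₂ (refl , _)) _ (inj₁ lt) _ _ = inj₁ lt
    invariant-step {p} {x} {q} {y} {r} {z} (inj₂ (refl , plusₓ , minusₓ)) (plus , minus) (inj₂ refl) p≢q q≢r =
      inj₂ (refl , plusᵣ , minusᵣ)
      where
      plusᵣ : p <ℙ r → sign z ≡ true
      plusᵣ p<r with ≢⇒<ℙ⊎>ℙ q≢r
      ... | inj₁ q<r = plus (refl , q<r)
      ... | inj₂ r<q = ⊥-elim (false≢true (trans (sym (minus (refl , r<q))) (plusₓ (<ℙ-trans p<r r<q))))
      minusᵣ : r <ℙ p → sign x ≡ false
      minusᵣ r<p with ≢⇒<ℙ⊎>ℙ p≢q | ≢⇒<ℙ⊎>ℙ q≢r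
      ... | inj₂ q<p | _ = minusₓ q<p
      ... | inj₁ p<q | inj₁ q<r = ⊥-elim (<ℙ-asym (<ℙ-trans p<q q<r) r<p)
      ... | inj₁ p<q | inj₂ r<q = ⊥-elim (false≢true (trans (sym (minus (refl , r<q))) (plusₓ p<q)))

    invariant-walk : ∀ a b zs → ChainInvariant a b → Linked AdjacentCompatible (b ∷ zs) →
                     AllPairs (λ c d → ∣ proj₂ c ∣ ≤ℙ ∣ proj₂ d ∣) (b ∷ zs) → AllPairs (λ c d → proj₁ c ≢ proj₁ d) (b ∷ zs) →
                     All (λ c → proj₁ a ≢ proj₁ c) (b ∷ zs) → All (ChainCompatible a) (b ∷ zs)
    invariant-walk a b [] inv _ _ _ _ = invariant⇒chainCompatible a b inv ∷ []
    invariant-walk a b (c ∷ zs) inv (adj ∷ linked) ((b≤c ∷ _) ∷ sorted) ((b≢c ∷ _) ∷ distinct) (a≢b ∷ a≢zs) =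
      invariant⇒chainCompatible a b inv
      ∷ invariant-walk a c zs (invariant-step inv adj b≤c a≢b b≢c) linked sorted distinct a≢zs

  adjacent⇒chainCompatible : ∀ zs → Linked AdjacentCompatible zs →
    AllPairs (λ c d → ∣ proj₂ c ∣ ≤ℙ ∣ proj₂ d ∣) zs → AllPairs (λ c d → proj₁ c ≢ proj₁ d) zs →
    AllPairs ChainCompatible zs
  adjacent⇒chainCompatible [] _ _ _ = []
  adjacent⇒chainCompatible (a ∷ []) _ _ _ = [] ∷ []
  adjacent⇒chainCompatible (a ∷ b ∷ zs) (adj ∷ linked) ((a≤b ∷ _) ∷ sorted) (a≢ ∷ distinct) =
    invariant-walk a b zs (adjacent⇒invariant adj a≤b) linked sorted distinct a≢
    ∷ adjacent⇒chainCompatible (b ∷ zs) linked sorted distinct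

  expand : Monomial m → List (ℙ m)
  expand [] = []
  expand ((i , j , e) ∷ μ) = replicate e (i , j) ++ expand μ

  occurrence : ℙ m → ℙ m → ℕ
  occurrence v y = if does (y ≟ℙ v) then 1 else 0

  multiplicity : ℙ m → List (ℙ m) → ℕ
  multiplicity v xs = sum (map (occurrence v) xs)

  multiplicity-++ : ∀ v xs ys → multiplicity v (xs ++ ys) ≡ multiplicity v xs + multiplicity v ys
  multiplicity-++ v [] ys = refl
  multiplicity-++ v (x ∷ xs) ys =
    trans (cong (occurrence v x +_) (multiplicity-++ v xs ys)) (sym (ℕ.+-assoc (occurrence v x) _ _))

  multiplicity-replicate : ∀ v u e → multiplicity v (replicate e u) ≡ (if does (u ≟ℙ v) then e else 0)
  multiplicity-replicate v u zero with does (u ≟ℙ v)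
  ... | true = refl
  ... | false = refl
  multiplicity-replicate v u (suc e) with does (u ≟ℙ v) | multiplicity-replicate v u e
  ... | true | ih = cong suc ih
  ... | false | ih = ih

  multiplicity-expand : ∀ μ i j → multiplicity (i , j) (expand μ) ≡ expo μ i j
  multiplicity-expand [] i j = refl
  multiplicity-expand ((i′ , j′ , e) ∷ μ) i j =
    trans (multiplicity-++ (i , j) (replicate e (i′ , j′)) (expand μ))
          (cong₂ _+_ (multiplicity-replicate (i , j) (i′ , j′) e) (multiplicity-expand μ i j))

  SameMultiset : List (ℙ m) → List (ℙ m) → Set
  SameMultiset xs ys = ∀ v → multiplicity v xs ≡ multiplicity v ys

  private
    multiplicity-head : ∀ v zs → 0 < multiplicity v (v ∷ zs)
    multiplicity-head v zs =
      subst (λ b → 0 < (if b then 1 else 0) + multiplicity v zs) (sym (dec-true (v ≟ℙ v) refl)) (s≤s z≤n)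

    multiplicity⇒∈ : ∀ v zs → 0 < multiplicity v zs → v ∈ zs
    multiplicity⇒∈ v (z ∷ zs) pos with z ≟ℙ v
    ... | yes refl = here refl
    ... | no z≢v = there (multiplicity⇒∈ v zs
                           (subst (λ b → 0 < (if b then 1 else 0) + multiplicity v zs) (dec-false (z ≟ℙ v) z≢v) pos))

    minimum : ∀ {a b bs} → All (b ≤ℙ_) bs → a ∈ b ∷ bs → b ≤ℙ a
    minimum _ (here refl) = inj₂ refl
    minimum b≤bs (there a∈bs) = All.lookup b≤bs a∈bs

  sorted-unique : ∀ xs ys → AllPairs _≤ℙ_ xs → AllPairs _≤ℙ_ ys → SameMultiset xs ys → xs ≡ ys
  sorted-unique [] [] _ _ _ = refl
  sorted-unique [] (y ∷ ys) _ _ same = ⊥-elim (ℕ.<-irrefl (same y) (multiplicity-head y ys))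
  sorted-unique (x ∷ xs) [] _ _ same = ⊥-elim (ℕ.<-irrefl (sym (same x)) (multiplicity-head x xs))
  sorted-unique (x ∷ xs) (y ∷ ys) (x≤xs ∷ sortedₓ) (y≤ys ∷ sortedᵧ) same =
    cong₂ _∷_ x≡y (sorted-unique xs ys sortedₓ sortedᵧ same′)
    where
    x≡y : x ≡ y
    x≡y = ≤ℙ-antisym (minimum x≤xs (multiplicity⇒∈ y (x ∷ xs) (subst (0 <_) (sym (same y)) (multiplicity-head y ys))))
                     (minimum y≤ys (multiplicity⇒∈ x (y ∷ ys) (subst (0 <_) (same x) (multiplicity-head x xs))))
    same′ : SameMultiset xs ys
    same′ v = ℕ.+-cancelˡ-≡ (occurrence v x) _ _ (trans (same v) (cong (λ z → occurrence v z + multiplicity v ys) (sym x≡y)))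

  VarsIncreasing : Monomial m → Set
  VarsIncreasing = Linked (λ s t → varOf s <ℙ varOf t)

  private
    expand-above : ∀ v μ → All (λ t → v <ℙ varOf t) μ → All (v ≤ℙ_) (expand μ)
    expand-above v [] [] = []
    expand-above v ((i , j , e) ∷ μ) (v<t ∷ v<μ) = All.++⁺ (All.replicate⁺ e (inj₁ v<t)) (expand-above v μ v<μ)

    head-below : ∀ t μ → VarsIncreasing (t ∷ μ) → All (λ t′ → varOf t <ℙ varOf t′) μ
    head-below t [] _ = []
    head-below t (t′ ∷ μ) (t<t′ ∷ increasing) = t<t′ ∷ All.map (<ℙ-trans t<t′) (head-below t′ μ increasing)

    replicate-sorted : ∀ e (v : ℙ m) → AllPairs _≤ℙ_ (replicate e v)
    replicate-sorted zero v = []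
    replicate-sorted (suc e) v = All.replicate⁺ e (inj₂ refl) ∷ replicate-sorted e v

  expand-sorted : ∀ μ → VarsIncreasing μ → AllPairs _≤ℙ_ (expand μ)
  expand-sorted [] _ = []
  expand-sorted ((i , j , e) ∷ μ) increasing =
    AllPairs.++⁺ (replicate-sorted e (i , j)) (expand-sorted μ (Linked.tail increasing))
                 (All.replicate⁺ e (expand-above (i , j) μ (head-below (i , j , e) μ increasing)))

  EnrichedChain : List (ℙ m) → Monomial m → List (ℙ± m) → Set
  EnrichedChain w μ ℓ = Pointwise AdmissibleAt w ℓ × AllPairs ChainCompatible (zip w ℓ)
                      × SameMultiset (map ∣_∣ ℓ) (expand μ)

  private
    values-zip : ∀ {w ℓ} → Pointwise AdmissibleAt w ℓ → map (∣_∣ ∘′ proj₂) (zip w ℓ) ≡ map ∣_∣ ℓ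
    values-zip {w} {ℓ} admissible = trans (map-∘ (zip w ℓ)) (cong (map ∣_∣) (map-proj₂-zip admissible))

  -- The values increase weakly along the chain, so they are the sorted expansion of μ.
  enrichedChain⇒locallyValid : ∀ w μ ℓ → AllPairs _≢_ w → VarsIncreasing μ →
                               EnrichedChain w μ ℓ → LocallyValid nothing w (expand μ) ℓ
  enrichedChain⇒locallyValid w μ ℓ distinct increasing (admissible , chain , same) =
    values≡ , admissible , Linked.map chainCompatible⇒adjacent (AllPairs⇒Linked chain) , noHead w ℓ
    where
    sortedZip : AllPairs (λ c d → ∣ proj₂ c ∣ ≤ℙ ∣ proj₂ d ∣) (zip w ℓ)
    sortedZip = AllPairs.zipWith (λ (compatible , p≢q) → chainCompatible⇒≤ℙ compatible p≢q)
                                 (chain , AllPairs-zip⁺ ℓ distinct)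
    values≡ : map ∣_∣ ℓ ≡ expand μ
    values≡ = sorted-unique _ _ (subst (AllPairs _≤ℙ_) (values-zip admissible) (AllPairs.map⁺ sortedZip))
                            (expand-sorted μ increasing) same
    noHead : ∀ w ℓ → HeadPlusForced nothing w ℓ
    noHead [] _ = tt
    noHead (_ ∷ _) [] = tt
    noHead (_ ∷ _) (_ ∷ _) = λ ()

  locallyValid⇒enrichedChain : ∀ w μ ℓ → AllPairs _≢_ w → VarsIncreasing μ →
                               LocallyValid nothing w (expand μ) ℓ → EnrichedChain w μ ℓ
  locallyValid⇒enrichedChain w μ ℓ distinct increasing (values≡ , admissible , adjacent , _) =
    admissible , adjacent⇒chainCompatible (zip w ℓ) adjacent sortedZip (AllPairs-zip⁺ ℓ distinct)
    , λ v → cong (multiplicity v) values≡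
    where
    sortedZip : AllPairs (λ c d → ∣ proj₂ c ∣ ≤ℙ ∣ proj₂ d ∣) (zip w ℓ)
    sortedZip = AllPairs.map⁻ (subst (AllPairs _≤ℙ_) (sym (trans (values-zip admissible) values≡))
                                     (expand-sorted μ increasing))

module _ {A B : Set} where

  Pointwise-toList⁺ : ∀ {R : A → B → Set} {n} (u : Vec A n) (v : Vec B n) →
                      (∀ k → R (lookup u k) (lookup v k)) → Pointwise R (toList u) (toList v)
  Pointwise-toList⁺ [] [] _ = []
  Pointwise-toList⁺ (x ∷ u) (y ∷ v) R-at = R-at fzero ∷ Pointwise-toList⁺ u v (λ k → R-at (fsuc k))

  Pointwise-toList⁻ : ∀ {R : A → B → Set} {n} (u : Vec A n) (v : Vec B n) →
                      Pointwise R (toList u) (toList v) → ∀ k → R (lookup u k) (lookup v k)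
  Pointwise-toList⁻ (x ∷ u) (y ∷ v) (r ∷ _) fzero = r
  Pointwise-toList⁻ (x ∷ u) (y ∷ v) (_ ∷ rs) (fsuc k) = Pointwise-toList⁻ u v rs k

  toList-zip : ∀ {n} (u : Vec A n) (v : Vec B n) → toList (Vec.zip u v) ≡ zip (toList u) (toList v)
  toList-zip [] [] = refl
  toList-zip (x ∷ u) (y ∷ v) = cong ((x , y) ∷_) (toList-zip u v)

module _ {A : Set} where

  All-toList⁺ : ∀ {P : A → Set} {n} (v : Vec A n) → (∀ k → P (lookup v k)) → All P (toList v)
  All-toList⁺ [] _ = []
  All-toList⁺ (x ∷ v) P-at = P-at fzero ∷ All-toList⁺ v (λ k → P-at (fsuc k))

  All-toList⁻ : ∀ {P : A → Set} {n} (v : Vec A n) → All P (toList v) → ∀ k → P (lookup v k)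
  All-toList⁻ (x ∷ v) (px ∷ _) fzero = px
  All-toList⁻ (x ∷ v) (_ ∷ pv) (fsuc k) = All-toList⁻ v pv k

  AllPairs-toList⁺ : ∀ {R : A → A → Set} {n} (v : Vec A n) →
                     (∀ a b → toℕ a < toℕ b → R (lookup v a) (lookup v b)) → AllPairs R (toList v)
  AllPairs-toList⁺ [] _ = []
  AllPairs-toList⁺ (x ∷ v) R-at = All-toList⁺ v (λ k → R-at fzero (fsuc k) (s≤s z≤n))
                                ∷ AllPairs-toList⁺ v (λ a b a<b → R-at (fsuc a) (fsuc b) (s≤s a<b))

  AllPairs-toList⁻ : ∀ {R : A → A → Set} {n} (v : Vec A n) →
                     AllPairs R (toList v) → ∀ a b → toℕ a < toℕ b → R (lookup v a) (lookup v b)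
  AllPairs-toList⁻ (x ∷ v) (x∼v ∷ _) fzero (fsuc b) _ = All-toList⁻ v x∼v b
  AllPairs-toList⁻ (x ∷ v) (_ ∷ rest) (fsuc a) (fsuc b) (s≤s a<b) = AllPairs-toList⁻ v rest a b a<b

  pad : A → (n : ℕ) → List A → Vec A n
  pad d zero _ = []
  pad d (suc n) [] = d ∷ pad d n []
  pad d (suc n) (x ∷ xs) = x ∷ pad d n xs

  toList-pad : ∀ d n (ℓ : List A) → length ℓ ≡ n → toList (pad d n ℓ) ≡ ℓ
  toList-pad d zero [] refl = refl
  toList-pad d (suc n) (x ∷ ℓ) refl = cong (x ∷_) (toList-pad d n ℓ refl)

toList-injective′ : ∀ {A : Set} {n} {u v : Vec A n} → toList u ≡ toList v → u ≡ v
toList-injective′ {u = u} {v} eq = trans (sym (cast-is-id refl u)) (toList-injective refl u v eq)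

module _ {m n : ℕ} where

  chainCompatible-toList⁺ : ∀ (π : Vec (ℙ m) n) (f : Vec (ℙ± m) n) →
    (∀ a b → toℕ a < toℕ b → ChainCompatible (lookup π a , lookup f a) (lookup π b , lookup f b)) →
    AllPairs ChainCompatible (zip (toList π) (toList f))
  chainCompatible-toList⁺ π f compatible =
    subst (AllPairs ChainCompatible) (toList-zip π f)
          (AllPairs-toList⁺ (Vec.zip π f) λ a b a<b →
             subst₂ ChainCompatible (sym (lookup-zip a π f)) (sym (lookup-zip b π f)) (compatible a b a<b))

  chainCompatible-toList⁻ : ∀ (π : Vec (ℙ m) n) (f : Vec (ℙ± m) n) →
    AllPairs ChainCompatible (zip (toList π) (toList f)) →
    ∀ a b → toℕ a < toℕ b → ChainCompatible (lookup π a , lookup f a) (lookup π b , lookup f b)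
  chainCompatible-toList⁻ π f chain a b a<b =
    subst₂ ChainCompatible (lookup-zip a π f) (lookup-zip b π f)
          (AllPairs-toList⁻ (Vec.zip π f) (subst (AllPairs ChainCompatible) (sym (toList-zip π f)) chain) a b a<b)

  isEnriched⇔enrichedChain : ∀ (π : Vec (ℙ m) n) (f : Vec (ℙ± m) n) μ →
    (IsEnriched π f × WeightIs f μ → EnrichedChain (toList π) μ (toList f))
    × (EnrichedChain (toList π) μ (toList f) → IsEnriched π f × WeightIs f μ)
  isEnriched⇔enrichedChain π f μ = to , from
    where
    to : IsEnriched π f × WeightIs f μ → EnrichedChain (toList π) μ (toList f)
    to ((positive , colour , plus , minus) , weight) =
      Pointwise-toList⁺ π f (λ k → positive k , colour k)
      , chainCompatible-toList⁺ π f (λ a b a<b → plus a b a<b , minus a b a<b)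
      , λ (i , j) → trans (cong sum (sym (map-∘ (toList f)))) (trans (weight i j) (sym (multiplicity-expand μ i j)))
    from : EnrichedChain (toList π) μ (toList f) → IsEnriched π f × WeightIs f μ
    from (admissible , chain , same) =
      ( (λ k → proj₁ (Pointwise-toList⁻ π f admissible k))
      , (λ k → proj₂ (Pointwise-toList⁻ π f admissible k))
      , (λ a b a<b → proj₁ (chainCompatible-toList⁻ π f chain a b a<b))
      , (λ a b a<b → proj₂ (chainCompatible-toList⁻ π f chain a b a<b)) )
      , λ i j → trans (cong sum (map-∘ (toList f))) (trans (same (i , j)) (multiplicity-expand μ i j))

  -- The default d only pads lists of the wrong length, which do not occur here.
  enriched-hasCard : (d : ℙ± m) (π : Vec (ℙ m) n) → AllPairs _≢_ (toList π) → (μ : Monomial m) → Canonical μ →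
    HasCard (λ f → IsEnriched π f × WeightIs f μ) (optionCount nothing (toList π) (expand μ))
  enriched-hasCard d π distinct μ (_ , increasing) =
    hasCard-retract toList (pad d n) toList∘pad toList-injective′ to from
      (hasCard-choices (optionLists nothing w (expand μ)) (optionLists-unique nothing w (expand μ)))
    where
    w : List (ℙ m)
    w = toList π
    toList∘pad : ∀ ℓ → Pointwise _∈_ ℓ (optionLists nothing w (expand μ)) → toList (pad d n ℓ) ≡ ℓ
    toList∘pad ℓ ℓ∈ with ∈-optionLists⁻ nothing w ℓ∈
    ... | _ , admissible , _ = toList-pad d n ℓ (trans (sym (Pointwise-length admissible)) (length-toList π))
    to : ∀ f → IsEnriched π f × WeightIs f μ → Pointwise _∈_ (toList f) (optionLists nothing w (expand μ))
    to f enriched = ∈-optionLists⁺ nothing w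
      (enrichedChain⇒locallyValid w μ (toList f) distinct increasing (proj₁ (isEnriched⇔enrichedChain π f μ) enriched))
    from : ∀ f → Pointwise _∈_ (toList f) (optionLists nothing w (expand μ)) → IsEnriched π f × WeightIs f μ
    from f f∈ = proj₂ (isEnriched⇔enrichedChain π f μ)
      (locallyValid⇒enrichedChain w μ (toList f) distinct increasing (∈-optionLists⁻ nothing w f∈))

-- Counting sign choices block by block

indicator : Bool → ℕ
indicator b = if b then 1 else 0

indicator-∧ : ∀ a b → indicator (a ∧ b) ≡ indicator a * indicator b
indicator-∧ false b = refl
indicator-∧ true b = sym (ℕ.+-identityʳ (indicator b))

module _ {A : Set} where

  take-++ˡ : ∀ n (xs ys : List A) → n ≤ length xs → take n (xs ++ ys) ≡ take n xs
  take-++ˡ zero xs ys _ = refl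
  take-++ˡ (suc n) (x ∷ xs) ys (s≤s n≤xs) = cong (x ∷_) (take-++ˡ n xs ys n≤xs)

  drop-++ˡ : ∀ n (xs ys : List A) → n ≤ length xs → drop n (xs ++ ys) ≡ drop n xs ++ ys
  drop-++ˡ zero xs ys _ = refl
  drop-++ˡ (suc n) (x ∷ xs) ys (s≤s n≤xs) = drop-++ˡ n xs ys n≤xs

  length-take-≤ : ∀ n (xs : List A) → n ≤ length xs → length (take n xs) ≡ n
  length-take-≤ n xs n≤xs = trans (length-take n xs) (ℕ.m≤n⇒m⊓n≡m n≤xs)

  ∈-take-head : ∀ {x : A} {xs} n → 1 ≤ n → x ∈ take n (x ∷ xs)
  ∈-take-head (suc n) _ = here refl

  ∈-take-++ : ∀ {y : A} {ys} n xs → length xs < n → y ∈ take n (xs ++ y ∷ ys)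
  ∈-take-++ (suc n) [] _ = here refl
  ∈-take-++ (suc n) (x ∷ xs) (s≤s xs<n) = there (∈-take-++ n xs xs<n)

  drop-nonEmpty : ∀ n (xs : List A) → n < length xs → drop n xs ≢ []
  drop-nonEmpty zero (x ∷ xs) _ ()
  drop-nonEmpty (suc n) (x ∷ xs) (s≤s n<xs) = drop-nonEmpty n xs n<xs

  take-nonEmpty : ∀ n (xs : List A) → 1 ≤ n → n ≤ length xs → take n xs ≢ []
  take-nonEmpty (suc n) (x ∷ xs) _ _ ()

  take-++-length : ∀ (xs ys : List A) → take (length xs) (xs ++ ys) ≡ xs
  take-++-length [] ys = refl
  take-++-length (x ∷ xs) ys = cong (x ∷_) (take-++-length xs ys)

  drop-++-length : ∀ (xs ys : List A) → drop (length xs) (xs ++ ys) ≡ ys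
  drop-++-length [] ys = refl
  drop-++-length (x ∷ xs) ys = drop-++-length xs ys

module _ {m : ℕ} where

  blockwiseCount : List (ℙ m) → Monomial m → ℕ
  blockwiseCount w [] = optionCount nothing w []
  blockwiseCount w ((i , j , e) ∷ μ) = optionCount nothing (take e w) (replicate e (i , j)) * blockwiseCount (drop e w) μ

  untied : Neighbour → ℙ m → ℙ m → ℕ
  untied nb p e with tie? nb p e
  ... | yes _ = 0
  ... | no _ = 1

  untied-tie : ∀ {nb p e} → Tie nb p e → untied nb p e ≡ 0
  untied-tie {nb} {p} {e} tie with tie? nb p e
  ... | yes _ = refl
  ... | no ¬tie = ⊥-elim (¬tie tie)

  untied-¬tie : ∀ {nb p e} → ¬ Tie nb p e → untied nb p e ≡ 1
  untied-¬tie {nb} {p} {e} ¬tie with tie? nb p e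
  ... | yes tie = ⊥-elim (¬tie tie)
  ... | no _ = refl

  length-signOptions : ∀ prev p e next → Admissible p e →
                       length (signOptions prev p e next) ≡ untied prev p e + untied next p e
  length-signOptions prev p e next ok with admissible? p e
  ... | no ¬ok = ⊥-elim (¬ok ok)
  ... | yes _ with tie? prev p e | tie? next p e
  ...   | yes _ | yes _ = refl
  ...   | yes _ | no _ = refl
  ...   | no _ | yes _ = refl
  ...   | no _ | no _ = refl

  increasing : List (ℙ m) → Bool
  increasing (a ∷ b ∷ r) = does (a <ℙ? b) ∧ increasing (b ∷ r)
  increasing _ = true

  -- Written with the peak test of peaksFrom.
  peakFree : List (ℙ m) → Bool
  peakFree (a ∷ b ∷ c ∷ r) = not (ltℙ a b ∧ ltℙ c b) ∧ peakFree (b ∷ c ∷ r)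
  peakFree _ = true

  private
    <ℙ-does : ∀ {a b : ℙ m} → a <ℙ b → ltℙ a b ≡ true
    <ℙ-does {a} {b} = dec-true (a <ℙ? b)

    ≮ℙ-does : ∀ {a b : ℙ m} → ¬ a <ℙ b → ltℙ a b ≡ false
    ≮ℙ-does {a} {b} = dec-false (a <ℙ? b)

    peakFree-ascent : ∀ x y r → Linked _≢_ (y ∷ r) → x <ℙ y → peakFree (x ∷ y ∷ r) ≡ increasing (y ∷ r)
    peakFree-ascent x y [] _ _ = refl
    peakFree-ascent x y (z ∷ r) (y≢z ∷ distinct) x<y with y <ℙ? z | ≢⇒<ℙ⊎>ℙ y≢z
    ... | yes y<z | _ = begin
      not (ltℙ x y ∧ ltℙ z y) ∧ peakFree (y ∷ z ∷ r)
        ≡⟨ cong₂ (λ a b → not (a ∧ b) ∧ peakFree (y ∷ z ∷ r)) (<ℙ-does x<y) (≮ℙ-does (<ℙ-asym y<z)) ⟩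
      peakFree (y ∷ z ∷ r)    ≡⟨ peakFree-ascent y z r distinct y<z ⟩
      increasing (z ∷ r)      ≡⟨ cong (_∧ increasing (z ∷ r)) (<ℙ-does y<z) ⟨
      increasing (y ∷ z ∷ r)  ∎
    ... | no y≮z | inj₁ y<z = ⊥-elim (y≮z y<z)
    ... | no y≮z | inj₂ z<y = trans (cong₂ (λ a b → not (a ∧ b) ∧ peakFree (y ∷ z ∷ r)) (<ℙ-does x<y) (<ℙ-does z<y))
                                    (sym (cong (_∧ increasing (z ∷ r)) (≮ℙ-does y≮z)))

    peakFree-descent : ∀ x y r → ¬ x <ℙ y → peakFree (x ∷ y ∷ r) ≡ peakFree (y ∷ r)
    peakFree-descent x y [] _ = refl
    peakFree-descent x y (z ∷ r) x≮y = cong (λ a → not (a ∧ ltℙ z y) ∧ peakFree (y ∷ z ∷ r)) (≮ℙ-does x≮y)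

  module _ (v : ℙ m) where

    private
      count-step : ∀ prev x s → Admissible x v →
        optionCount prev (x ∷ s) (replicate (suc (length s)) v)
        ≡ (untied prev x v + untied (nextNeighbour s (replicate (length s) v)) x v)
          * optionCount (just (x , v)) s (replicate (length s) v)
      count-step prev x s ok = cong (_* optionCount (just (x , v)) s (replicate (length s) v))
                                    (length-signOptions prev x v (nextNeighbour s (replicate (length s) v)) ok)

      untied-below : ∀ {y x} → y <ℙ x → untied (just (y , v)) x v ≡ 0
      untied-below y<x = untied-tie (refl , y<x)

      untied-notBelow : ∀ {y x} → ¬ y <ℙ x → untied (just (y , v)) x v ≡ 1
      untied-notBelow y≮x = untied-¬tie (λ (_ , y<x) → y≮x y<x)

    -- Once a value block has started with an ascent, every later position is forced to +.
    ascending-count : ∀ x′ x s → All (λ y → Admissible y v) (x ∷ s) → Linked _≢_ (x ∷ s) → x′ <ℙ x →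
      optionCount (just (x′ , v)) (x ∷ s) (replicate (suc (length s)) v) ≡ indicator (increasing (x ∷ s))
    ascending-count x′ x [] (ok ∷ _) _ x′<x =
      trans (count-step (just (x′ , v)) x [] ok) (cong (λ k → (k + 1) * 1) (untied-below x′<x))
    ascending-count x′ x (y ∷ s) (ok ∷ oks) (x≢y ∷ distinct) x′<x with x <ℙ? y | ≢⇒<ℙ⊎>ℙ x≢y
    ... | yes x<y | _ = begin
      optionCount (just (x′ , v)) (x ∷ y ∷ s) (replicate (2 + length s) v)
        ≡⟨ count-step (just (x′ , v)) x (y ∷ s) ok ⟩
      (untied (just (x′ , v)) x v + untied (just (y , v)) x v) * optionCount (just (x , v)) (y ∷ s) (replicate (suc (length s)) v)
        ≡⟨ cong₂ (λ a b → (a + b) * optionCount (just (x , v)) (y ∷ s) (replicate (suc (length s)) v))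
                 (untied-below x′<x) (untied-notBelow (<ℙ-asym x<y)) ⟩
      1 * optionCount (just (x , v)) (y ∷ s) (replicate (suc (length s)) v)
        ≡⟨ trans (ℕ.*-identityˡ _) (ascending-count x y s oks distinct x<y) ⟩
      indicator (increasing (y ∷ s))
        ≡⟨ cong (λ b → indicator (b ∧ increasing (y ∷ s))) (<ℙ-does x<y) ⟨
      indicator (increasing (x ∷ y ∷ s)) ∎
    ... | no x≮y | inj₁ x<y = ⊥-elim (x≮y x<y)
    ... | no x≮y | inj₂ y<x = begin
      optionCount (just (x′ , v)) (x ∷ y ∷ s) (replicate (2 + length s) v)
        ≡⟨ count-step (just (x′ , v)) x (y ∷ s) ok ⟩
      (untied (just (x′ , v)) x v + untied (just (y , v)) x v) * optionCount (just (x , v)) (y ∷ s) (replicate (suc (length s)) v)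
        ≡⟨ cong₂ (λ a b → (a + b) * optionCount (just (x , v)) (y ∷ s) (replicate (suc (length s)) v))
                 (untied-below x′<x) (untied-below y<x) ⟩
      0
        ≡⟨ cong (λ b → indicator (b ∧ increasing (y ∷ s))) (≮ℙ-does x≮y) ⟨
      indicator (increasing (x ∷ y ∷ s)) ∎

    -- While the block descends both signs stay free at its minimum, hence the factor 2.
    descending-count : ∀ prev x s → All (λ y → Admissible y v) (x ∷ s) → Linked _≢_ (x ∷ s) → ¬ Tie prev x v →
      optionCount prev (x ∷ s) (replicate (suc (length s)) v) ≡ 2 * indicator (peakFree (x ∷ s))
    descending-count prev x [] (ok ∷ _) _ untiedₚ =
      trans (count-step prev x [] ok) (cong (λ k → (k + 1) * 1) (untied-¬tie untiedₚ))
    descending-count prev x (y ∷ s) (ok ∷ oks) (x≢y ∷ distinct) untiedₚ with x <ℙ? y | ≢⇒<ℙ⊎>ℙ x≢y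
    ... | yes x<y | _ = begin
      optionCount prev (x ∷ y ∷ s) (replicate (2 + length s) v)
        ≡⟨ count-step prev x (y ∷ s) ok ⟩
      (untied prev x v + untied (just (y , v)) x v) * optionCount (just (x , v)) (y ∷ s) (replicate (suc (length s)) v)
        ≡⟨ cong₂ (λ a b → (a + b) * optionCount (just (x , v)) (y ∷ s) (replicate (suc (length s)) v))
                 (untied-¬tie untiedₚ) (untied-notBelow (<ℙ-asym x<y)) ⟩
      2 * optionCount (just (x , v)) (y ∷ s) (replicate (suc (length s)) v)
        ≡⟨ cong (2 *_) (ascending-count x y s oks distinct x<y) ⟩
      2 * indicator (increasing (y ∷ s))
        ≡⟨ cong (λ b → 2 * indicator b) (peakFree-ascent x y s distinct x<y) ⟨
      2 * indicator (peakFree (x ∷ y ∷ s)) ∎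
    ... | no x≮y | inj₁ x<y = ⊥-elim (x≮y x<y)
    ... | no x≮y | inj₂ y<x = begin
      optionCount prev (x ∷ y ∷ s) (replicate (2 + length s) v)
        ≡⟨ count-step prev x (y ∷ s) ok ⟩
      (untied prev x v + untied (just (y , v)) x v) * optionCount (just (x , v)) (y ∷ s) (replicate (suc (length s)) v)
        ≡⟨ cong₂ (λ a b → (a + b) * optionCount (just (x , v)) (y ∷ s) (replicate (suc (length s)) v))
                 (untied-¬tie untiedₚ) (untied-below y<x) ⟩
      1 * optionCount (just (x , v)) (y ∷ s) (replicate (suc (length s)) v)
        ≡⟨ trans (ℕ.*-identityˡ _) (descending-count (just (x , v)) y s oks distinct λ (_ , x<y) → x≮y x<y) ⟩
      2 * indicator (peakFree (y ∷ s))
        ≡⟨ cong (λ b → 2 * indicator b) (peakFree-descent x y s x≮y) ⟨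
      2 * indicator (peakFree (x ∷ y ∷ s)) ∎

    inadmissible-count : ∀ prev s {x} → x ∈ s → ¬ Admissible x v → optionCount prev s (replicate (length s) v) ≡ 0
    inadmissible-count prev (x ∷ s) (here refl) ¬ok =
      cong (_* optionCount (just (x , v)) s (replicate (length s) v)) (length-signOptions-¬ok (nextNeighbour s (replicate (length s) v)))
      where
      length-signOptions-¬ok : ∀ next → length (signOptions prev x v next) ≡ 0
      length-signOptions-¬ok next with admissible? x v
      ... | yes ok = ⊥-elim (¬ok ok)
      ... | no _ = refl
    inadmissible-count prev (y ∷ s) (there x∈s) ¬ok =
      trans (cong (length (signOptions prev y v (nextNeighbour s (replicate (length s) v))) *_)
                  (inadmissible-count (just (y , v)) s x∈s ¬ok))
            (ℕ.*-zeroʳ (length (signOptions prev y v (nextNeighbour s (replicate (length s) v)))))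

  fits : ℙ m → Fin m → Bool
  fits v c = does (fits? v c)

  valueBlock-count : ∀ v c s → s ≢ [] → All (λ y → proj₂ y ≡ c) s → Linked _≢_ s →
    optionCount nothing s (replicate (length s) v) ≡ indicator (fits v c) * (2 * indicator (peakFree s))
  valueBlock-count v c [] s≢[] _ _ = ⊥-elim (s≢[] refl)
  valueBlock-count v c (x ∷ s) _ colours distinct with fits? v c
  ... | yes v-fits@(pos , v-c) = begin
    optionCount nothing (x ∷ s) (replicate (suc (length s)) v)
      ≡⟨ descending-count v nothing x s (All.map (λ y-c → pos , trans v-c (sym y-c)) colours) distinct (λ ()) ⟩
    2 * indicator (peakFree (x ∷ s))
      ≡⟨ ℕ.*-identityˡ _ ⟨
    1 * (2 * indicator (peakFree (x ∷ s)))
      ≡⟨ cong (λ b → indicator b * (2 * indicator (peakFree (x ∷ s)))) (dec-true (fits? v c) v-fits) ⟨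
    indicator (fits v c) * (2 * indicator (peakFree (x ∷ s))) ∎
  ... | no ¬fits = begin
    optionCount nothing (x ∷ s) (replicate (suc (length s)) v)
      ≡⟨ inadmissible-count v nothing (x ∷ s) (here refl) (λ (pos , v-x) → ¬fits (pos , trans v-x (All.head colours))) ⟩
    0
      ≡⟨ cong (λ b → indicator b * (2 * indicator (peakFree (x ∷ s)))) (dec-false (fits? v c) ¬fits) ⟨
    indicator (fits v c) * (2 * indicator (peakFree (x ∷ s))) ∎

  private
    minusOption-untied : ∀ {nb} {p e : ℙ m} → ¬ Tie nb p e → minusOption nb p e ≡ (false , e) ∷ []
    minusOption-untied {nb} {p} {e} ¬tie with tie? nb p e
    ... | yes tie = ⊥-elim (¬tie tie)
    ... | no _ = refl

    plusOption-untied : ∀ {nb} {p e : ℙ m} → ¬ Tie nb p e → plusOption nb p e ≡ (true , e) ∷ []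
    plusOption-untied {nb} {p} {e} ¬tie with tie? nb p e
    ... | yes tie = ⊥-elim (¬tie tie)
    ... | no _ = refl

    signOptions-prev : ∀ {prev prev′} {p e : ℙ m} {next} → ¬ Tie prev p e → ¬ Tie prev′ p e →
                       signOptions prev p e next ≡ signOptions prev′ p e next
    signOptions-prev {prev} {prev′} {p} {e} {next} ¬tie ¬tie′ with admissible? p e
    ... | yes _ = cong (_++ plusOption next p e) (trans (minusOption-untied ¬tie) (sym (minusOption-untied ¬tie′)))
    ... | no _ = refl

    signOptions-next : ∀ {prev} {p e : ℙ m} {next next′} → ¬ Tie next p e → ¬ Tie next′ p e →
                       signOptions prev p e next ≡ signOptions prev p e next′
    signOptions-next {prev} {p} {e} {next} {next′} ¬tie ¬tie′ with admissible? p e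
    ... | yes _ = cong (minusOption prev p e ++_) (trans (plusOption-untied ¬tie) (sym (plusOption-untied ¬tie′)))
    ... | no _ = refl

    ¬tie-valueChange : ∀ {q e′ p e : ℙ m} → e′ ≢ e → ¬ Tie (just (q , e′)) p e
    ¬tie-valueChange e′≢e (e′≡e , _) = e′≢e e′≡e

    forget-prev : ∀ x v w E → head E ≢ just v → optionLists (just (x , v)) w E ≡ optionLists nothing w E
    forget-prev x v [] [] _ = refl
    forget-prev x v [] (_ ∷ _) _ = refl
    forget-prev x v (_ ∷ _) [] _ = refl
    forget-prev x v (p ∷ w) (e ∷ E) e≢v = cong (_∷ optionLists (just (p , e)) w E) (signOptions-prev (¬tie-valueChange λ v≡e → e≢v (cong just (sym v≡e))) λ ())

    forget-next : ∀ prev x v w E → head E ≢ just v →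
                  signOptions prev x v (nextNeighbour w E) ≡ signOptions prev x v nothing
    forget-next prev x v [] E _ = refl
    forget-next prev x v (_ ∷ _) [] _ = refl
    forget-next prev x v (q ∷ w) (e ∷ E) e≢v = signOptions-next (¬tie-valueChange λ e≡v → e≢v (cong just e≡v)) λ ()

  optionLists-split : ∀ prev e w v E → 1 ≤ e → e ≤ length w → head E ≢ just v →
    optionLists prev w (replicate e v ++ E) ≡ optionLists prev (take e w) (replicate e v) ++ optionLists nothing (drop e w) E
  optionLists-split prev 1 (x ∷ w) v E _ _ E≢v = cong₂ _∷_ (forget-next prev x v w E E≢v) (forget-prev x v w E E≢v)
  optionLists-split prev (suc (suc e)) (x ∷ y ∷ w) v E _ (s≤s e≤w) E≢v =
    cong (signOptions prev x v (just (y , v)) ∷_) (optionLists-split (just (x , v)) (suc e) (y ∷ w) v E (s≤s z≤n) e≤w E≢v)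

  shortWord-count : ∀ prev (w E : List (ℙ m)) → length w < length E → optionCount prev w E ≡ 0
  shortWord-count prev [] (e ∷ E) _ = refl
  shortWord-count prev (p ∷ w) (e ∷ E) (s≤s w<E) =
    trans (cong (length (signOptions prev p e (nextNeighbour w E)) *_) (shortWord-count (just (p , e)) w E w<E))
          (ℕ.*-zeroʳ (length (signOptions prev p e (nextNeighbour w E))))

  canonical-tail : ∀ {t μ} → Canonical {m} (t ∷ μ) → Canonical μ
  canonical-tail (_ ∷ bounds , increasing) = bounds , Linked.tail increasing

  private
    canonical-head : ∀ i j e μ → Canonical {m} ((i , j , e) ∷ μ) → head (expand μ) ≢ just (i , j)
    canonical-head i j e [] _ ()
    canonical-head i j e ((i′ , j′ , suc e′) ∷ μ) (_ , lt ∷ _) eq = <ℙ-irrefl (subst ((i , j) <ℙ_) (just-injective eq) lt)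
    canonical-head i j e ((i′ , j′ , zero) ∷ μ) (_ ∷ (_ , ()) ∷ _ , _)

  optionCount≡blockwiseCount : ∀ w μ → Canonical μ → optionCount nothing w (expand μ) ≡ blockwiseCount w μ
  optionCount≡blockwiseCount w [] _ = refl
  optionCount≡blockwiseCount w ((i , j , e) ∷ μ) canonical@((_ , e≥1) ∷ _ , _) with e ℕ.≤? length w
  ... | yes e≤w = begin
    optionCount nothing w (replicate e (i , j) ++ expand μ)
      ≡⟨ cong (λ O → product (map length O)) (optionLists-split nothing e w (i , j) (expand μ) e≥1 e≤w (canonical-head i j e μ canonical)) ⟩
    product (map length (optionLists nothing (take e w) (replicate e (i , j)) ++ optionLists nothing (drop e w) (expand μ)))
      ≡⟨ cong product (map-++ length (optionLists nothing (take e w) (replicate e (i , j))) _) ⟩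
    product (map length (optionLists nothing (take e w) (replicate e (i , j))) ++ map length (optionLists nothing (drop e w) (expand μ)))
      ≡⟨ product-++ (map length (optionLists nothing (take e w) (replicate e (i , j)))) _ ⟩
    optionCount nothing (take e w) (replicate e (i , j)) * optionCount nothing (drop e w) (expand μ)
      ≡⟨ cong (optionCount nothing (take e w) (replicate e (i , j)) *_) (optionCount≡blockwiseCount (drop e w) μ (canonical-tail canonical)) ⟩
    blockwiseCount w ((i , j , e) ∷ μ) ∎
  ... | no e≰w = begin
    optionCount nothing w (replicate e (i , j) ++ expand μ)
      ≡⟨ shortWord-count nothing w (replicate e (i , j) ++ expand μ) w<E ⟩
    0
      ≡⟨ cong (_* blockwiseCount (drop e w) μ) (shortWord-count nothing (take e w) (replicate e (i , j)) take<e) ⟨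
    blockwiseCount w ((i , j , e) ∷ μ) ∎
    where
    w<e : length w < e
    w<e = ℕ.≰⇒> e≰w
    w<E : length w < length (replicate e (i , j) ++ expand μ)
    w<E = ℕ.<-≤-trans w<e (subst (e ≤_) (sym (trans (length-++ (replicate e (i , j))) (cong (_+ length (expand μ)) (length-replicate e))))
                                    (ℕ.m≤m+n e (length (expand μ))))
    take<e : length (take e w) < length (replicate e (i , j))
    take<e = subst₂ _<_ (sym (cong length (take-all e w (ℕ.<⇒≤ w<e)))) (sym (length-replicate e)) w<e

-- Rainbow decompositions

module _ {m : ℕ} {A : Set} (col : A → Fin m) where

  Monochrome : Fin m × List A → Set
  Monochrome (c , xs) = xs ≢ [] × All (λ x → col x ≡ c) xs

  IsRainbow : List (Fin m × List A) → Set
  IsRainbow R = All Monochrome R × Linked (λ b b′ → proj₁ b ≢ proj₁ b′) R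

  flatten : List (Fin m × List A) → List A
  flatten = concatMap proj₂

  runs-isRainbow : ∀ L → IsRainbow (runs col L) × flatten (runs col L) ≡ L
  runs-isRainbow [] = ([] , []) , refl
  runs-isRainbow (x ∷ xs) with runs col xs | runs-isRainbow xs
  ... | [] | _ , refl = (((λ ()) , refl ∷ []) ∷ [] , [-]) , refl
  ... | (c , ys) ∷ rest | ((ys≢[] , ys-c) ∷ mono , linked) , refl with col x Fin.≟ c
  ...   | yes x-c = (((λ ()) , x-c ∷ ys-c) ∷ mono , relabel linked) , refl
    where
    relabel : Linked (λ b b′ → proj₁ b ≢ proj₁ b′) ((c , ys) ∷ rest) → Linked (λ b b′ → proj₁ b ≢ proj₁ b′) ((c , x ∷ ys) ∷ rest)
    relabel [-] = [-]
    relabel (c≢ ∷ linked′) = c≢ ∷ linked′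
  ...   | no x≁c = (((λ ()) , refl ∷ []) ∷ (ys≢[] , ys-c) ∷ mono , x≁c ∷ linked) , refl

  StartsOff : Fin m → List A → Set
  StartsOff c L = Maybe.map col (head L) ≢ just c

  private
    monochrome-prefix : ∀ c u₁ u₂ L₁ L₂ → All (λ x → col x ≡ c) u₁ → All (λ x → col x ≡ c) u₂ →
                        StartsOff c L₁ → StartsOff c L₂ → u₁ ++ L₁ ≡ u₂ ++ L₂ → u₁ ≡ u₂ × L₁ ≡ L₂
    monochrome-prefix c [] [] L₁ L₂ _ _ _ _ eq = refl , eq
    monochrome-prefix c [] (y ∷ u₂) .(y ∷ u₂ ++ L₂) L₂ _ (y-c ∷ _) off₁ _ refl = ⊥-elim (off₁ (cong just y-c))
    monochrome-prefix c (x ∷ u₁) [] L₁ .(x ∷ u₁ ++ L₁) (x-c ∷ _) _ _ off₂ refl = ⊥-elim (off₂ (cong just x-c))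
    monochrome-prefix c (x ∷ u₁) (y ∷ u₂) L₁ L₂ (_ ∷ u₁-c) (_ ∷ u₂-c) off₁ off₂ eq with ∷-injective eq
    ... | refl , eq′ with monochrome-prefix c u₁ u₂ L₁ L₂ u₁-c u₂-c off₁ off₂ eq′
    ...   | refl , L₁≡L₂ = refl , L₁≡L₂

  rainbow-startsOff : ∀ b R → IsRainbow (b ∷ R) → StartsOff (proj₁ b) (flatten R)
  rainbow-startsOff b [] _ ()
  rainbow-startsOff b ((c′ , []) ∷ R) (_ ∷ ((nonEmpty , _) ∷ _) , _) _ = nonEmpty refl
  rainbow-startsOff b ((c′ , z ∷ u) ∷ R) (_ ∷ ((_ , z-c′ ∷ _) ∷ _) , b≢ ∷ _) z-b =
    b≢ (trans (sym (just-injective z-b)) z-c′)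

  rainbow-tail : ∀ {b R} → IsRainbow (b ∷ R) → IsRainbow R
  rainbow-tail (_ ∷ mono , linked) = mono , Linked.tail linked

  rainbow-unique : ∀ R₁ R₂ → IsRainbow R₁ → IsRainbow R₂ → flatten R₁ ≡ flatten R₂ → R₁ ≡ R₂
  rainbow-unique [] [] _ _ _ = refl
  rainbow-unique [] ((c , []) ∷ R₂) _ ((nonEmpty , _) ∷ _ , _) _ = ⊥-elim (nonEmpty refl)
  rainbow-unique ((c , []) ∷ R₁) R₂ ((nonEmpty , _) ∷ _ , _) _ _ = ⊥-elim (nonEmpty refl)
  rainbow-unique ((c₁ , x ∷ u₁) ∷ R₁) ((c₂ , []) ∷ R₂) _ ((nonEmpty , _) ∷ _ , _) _ = ⊥-elim (nonEmpty refl)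
  rainbow-unique ((c₁ , x ∷ u₁) ∷ R₁) ((c₂ , y ∷ u₂) ∷ R₂) rainbow₁@((_ , x-c₁ ∷ u₁-c₁) ∷ _ , _) rainbow₂@((_ , y-c₂ ∷ u₂-c₂) ∷ _ , _) eq
    with ∷-injective eq
  ... | refl , _ with trans (sym x-c₁) y-c₂
  ...   | refl with monochrome-prefix c₁ (x ∷ u₁) (x ∷ u₂) (flatten R₁) (flatten R₂) (x-c₁ ∷ u₁-c₁) (y-c₂ ∷ u₂-c₂)
                      (rainbow-startsOff _ R₁ rainbow₁) (rainbow-startsOff _ R₂ rainbow₂) eq
  ...     | refl , flat≡ = cong ((c₁ , x ∷ u₁) ∷_) (rainbow-unique R₁ R₂ (rainbow-tail rainbow₁) (rainbow-tail rainbow₂) flat≡)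

-- Cutting a word after a monochrome run

module _ {m : ℕ} where

  exponents : Monomial m → List ℕ
  exponents = map (λ t → proj₂ (proj₂ t))

  peakFreeBlocks : List (ℙ m) → List ℕ → Bool
  peakFreeBlocks u [] = null u
  peakFreeBlocks u (b ∷ β) = peakFree (take b u) ∧ peakFreeBlocks (drop b u) β

  AllFit : Monomial m → Fin m → Set
  AllFit ν c = All (λ t → Fits (varOf t) c) ν

  allFit? : (ν : Monomial m) (c : Fin m) → Dec (AllFit ν c)
  allFit? ν c = All.all? (λ t → fits? (varOf t) c) ν

  allFit : Monomial m → Fin m → Bool
  allFit ν c = does (allFit? ν c)

  monochrome-count : ∀ u c ν → All (λ y → proj₂ y ≡ c) u → AllPairs _≢_ u →
    All (λ t → 1 ≤ proj₂ (proj₂ t)) ν → sum (exponents ν) ≡ length u →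
    blockwiseCount u ν ≡ indicator (allFit ν c) * (2 ^ length ν * indicator (peakFreeBlocks u (exponents ν)))
  monochrome-count [] c [] _ _ _ _ = refl
  monochrome-count (_ ∷ _) c [] _ _ _ ()
  monochrome-count u c ((i , j , e) ∷ ν) colours distinct (e≥1 ∷ exps≥1) sum≡ = begin
    optionCount nothing (take e u) (replicate e (i , j)) * blockwiseCount (drop e u) ν
      ≡⟨ cong₂ _*_ firstBlock (monochrome-count (drop e u) c ν (All.drop⁺ e colours) (AllPairs.drop⁺ e distinct) exps≥1 sum≡′) ⟩
    indicator a * (2 * indicator b) * (indicator a′ * (2 ^ length ν * indicator b′))
      ≡⟨ rearrange (indicator a) (indicator b) (indicator a′) (2 ^ length ν) (indicator b′) ⟩
    indicator a * indicator a′ * (2 * 2 ^ length ν * (indicator b * indicator b′))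
      ≡⟨ cong₂ (λ x y → x * (2 * 2 ^ length ν * y)) (indicator-∧ a a′) (indicator-∧ b b′) ⟨
    indicator (a ∧ a′) * (2 ^ suc (length ν) * indicator (b ∧ b′)) ∎
    where
    a a′ b b′ : Bool
    a = fits (i , j) c
    a′ = allFit ν c
    b = peakFree (take e u)
    b′ = peakFreeBlocks (drop e u) (exponents ν)
    e≤u : e ≤ length u
    e≤u = subst (e ≤_) sum≡ (ℕ.m≤m+n e (sum (exponents ν)))
    sum≡′ : sum (exponents ν) ≡ length (drop e u)
    sum≡′ = trans (sym (ℕ.m+n∸m≡n e (sum (exponents ν)))) (trans (cong (_∸ e) sum≡) (sym (length-drop e u)))
    firstBlock : optionCount nothing (take e u) (replicate e (i , j)) ≡ indicator a * (2 * indicator b)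
    firstBlock = subst (λ k → optionCount nothing (take e u) (replicate k (i , j)) ≡ indicator a * (2 * indicator b))
                       (length-take-≤ e u e≤u)
                       (valueBlock-count (i , j) c (take e u) (take-nonEmpty e u e≥1 e≤u) (All.take⁺ e colours)
                                         (AllPairs⇒Linked (AllPairs.take⁺ e distinct)))
    rearrange : ∀ A B C K D → A * (2 * B) * (C * (K * D)) ≡ A * C * (2 * K * (B * D))
    rearrange = solve-∀

prefixLength : ℕ → List ℕ → Maybe ℕ
prefixLength zero _ = just zero
prefixLength (suc n) [] = nothing
prefixLength (suc n) (e ∷ X) = if e ≤ᵇ suc n then Maybe.map suc (prefixLength (suc n ∸ e) X) else nothing

prefixLength-≤ : ∀ n e X → e ≤ suc n → prefixLength (suc n) (e ∷ X) ≡ Maybe.map suc (prefixLength (suc n ∸ e) X)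
prefixLength-≤ n e X e≤n = cong (λ b → if b then Maybe.map suc (prefixLength (suc n ∸ e) X) else nothing) (dec-true (e ℕ.≤? suc n) e≤n)

prefixLength-> : ∀ n e X → ¬ e ≤ suc n → prefixLength (suc n) (e ∷ X) ≡ nothing
prefixLength-> n e X e≰n = cong (λ b → if b then Maybe.map suc (prefixLength (suc n ∸ e) X) else nothing) (dec-false (e ℕ.≤? suc n) e≰n)

module _ {m : ℕ} where

  splitCount : List (ℙ m) → (Monomial m → ℕ) → Monomial m → Maybe ℕ → ℕ
  splitCount u F μ = maybe′ (λ k → blockwiseCount u (take k μ) * F (drop k μ)) 0

  private
    short-block : ∀ (w : List (ℙ m)) v e → length w < e → optionCount nothing (take e w) (replicate e v) ≡ 0
    short-block w v e w<e = shortWord-count nothing (take e w) (replicate e v)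
      (subst₂ _<_ (sym (cong length (take-all e w (ℕ.<⇒≤ w<e)))) (sym (length-replicate e)) w<e)

    -- A block reaching past u contains the first letters of u and of w′, of different colours.
    overlong-count : ∀ (x : ℙ m) u₀ w′ c v e → let u = x ∷ u₀ in length u < e → All (λ y → proj₂ y ≡ c) u → StartsOff proj₂ c w′ →
                     optionCount nothing (take e (u ++ w′)) (replicate e v) ≡ 0
    overlong-count x u₀ [] c v e u<e _ _ = short-block (x ∷ u₀ ++ []) v e (subst (_< e) (sym (cong length (++-identityʳ (x ∷ u₀)))) u<e)
    overlong-count x u₀ (y ∷ w″) c v e u<e (x-c ∷ _) y≁c with e ℕ.≤? length (x ∷ u₀ ++ y ∷ w″)
    ... | no e≰uw = short-block (x ∷ u₀ ++ y ∷ w″) v e (ℕ.≰⇒> e≰uw)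
    ... | yes e≤uw = subst (λ k → optionCount nothing s (replicate k v) ≡ 0) (length-take-≤ e (x ∷ u₀ ++ y ∷ w″) e≤uw) twoColours
      where
      s : List (ℙ m)
      s = take e (x ∷ u₀ ++ y ∷ w″)
      twoColours : optionCount nothing s (replicate (length s) v) ≡ 0
      twoColours with admissible? x v
      ... | no ¬ok = inadmissible-count v nothing s (∈-take-head e (ℕ.<-trans (s≤s z≤n) u<e)) ¬ok
      ... | yes (_ , v-x) = inadmissible-count v nothing s (∈-take-++ e (x ∷ u₀) u<e) λ (_ , v-y) → y≁c (cong just (trans (sym v-y) (trans v-x x-c)))

  blockwiseCount-++ : ∀ u w′ μ c → u ≢ [] → All (λ y → proj₂ y ≡ c) u → StartsOff proj₂ c w′ →
    blockwiseCount (u ++ w′) μ ≡ splitCount u (blockwiseCount w′) μ (prefixLength (length u) (exponents μ))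
  blockwiseCount-++ [] w′ μ c u≢[] _ _ = ⊥-elim (u≢[] refl)
  blockwiseCount-++ (x ∷ u₀) w′ [] c _ _ _ = refl
  blockwiseCount-++ u@(x ∷ u₀) w′ ((i , j , e) ∷ μ) c _ colours offColour with ℕ.<-cmp e (length u)
  ... | tri< e<u _ _ = begin
    first (take e (u ++ w′)) * blockwiseCount (drop e (u ++ w′)) μ
      ≡⟨ cong₂ (λ s t → first s * blockwiseCount t μ) (take-++ˡ e u w′ e≤u) (drop-++ˡ e u w′ e≤u) ⟩
    first (take e u) * blockwiseCount (drop e u ++ w′) μ
      ≡⟨ cong (first (take e u) *_) (blockwiseCount-++ (drop e u) w′ μ c (drop-nonEmpty e u e<u) (All.drop⁺ e colours) offColour) ⟩
    first (take e u) * splitCount (drop e u) (blockwiseCount w′) μ (prefixLength (length (drop e u)) (exponents μ))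
      ≡⟨ cong (λ n → first (take e u) * splitCount (drop e u) (blockwiseCount w′) μ (prefixLength n (exponents μ))) (length-drop e u) ⟩
    first (take e u) * splitCount (drop e u) (blockwiseCount w′) μ (prefixLength (length u ∸ e) (exponents μ))
      ≡⟨ extend (prefixLength (length u ∸ e) (exponents μ)) ⟩
    splitCount u (blockwiseCount w′) ((i , j , e) ∷ μ) (Maybe.map suc (prefixLength (length u ∸ e) (exponents μ)))
      ≡⟨ cong (splitCount u (blockwiseCount w′) ((i , j , e) ∷ μ)) (prefixLength-≤ (length u₀) e (exponents μ) e≤u) ⟨
    splitCount u (blockwiseCount w′) ((i , j , e) ∷ μ) (prefixLength (length u) (exponents ((i , j , e) ∷ μ))) ∎
    where
    first : List (ℙ m) → ℕ
    first s = optionCount nothing s (replicate e (i , j))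
    e≤u : e ≤ length u
    e≤u = ℕ.<⇒≤ e<u
    extend : ∀ r → first (take e u) * splitCount (drop e u) (blockwiseCount w′) μ r ≡ splitCount u (blockwiseCount w′) ((i , j , e) ∷ μ) (Maybe.map suc r)
    extend (just k) = sym (ℕ.*-assoc (first (take e u)) (blockwiseCount (drop e u) (take k μ)) (blockwiseCount w′ (drop k μ)))
    extend nothing = ℕ.*-zeroʳ (first (take e u))
  ... | tri≈ _ refl _ = begin
    first (take e (u ++ w′)) * blockwiseCount (drop e (u ++ w′)) μ
      ≡⟨ cong₂ (λ s t → first s * blockwiseCount t μ) (take-++ˡ e u w′ ℕ.≤-refl) (drop-++ˡ e u w′ ℕ.≤-refl) ⟩
    first (take e u) * blockwiseCount (drop e u ++ w′) μ
      ≡⟨ cong (λ t → first (take e u) * blockwiseCount (t ++ w′) μ) (drop-all e u ℕ.≤-refl) ⟩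
    first (take e u) * blockwiseCount w′ μ
      ≡⟨ cong (_* blockwiseCount w′ μ) (trans (cong (λ t → first (take e u) * blockwiseCount t []) (drop-all e u ℕ.≤-refl))
                                             (ℕ.*-identityʳ (first (take e u)))) ⟨
    blockwiseCount u ((i , j , e) ∷ []) * blockwiseCount w′ μ
      ≡⟨ cong (splitCount u (blockwiseCount w′) ((i , j , e) ∷ μ))
              (trans (prefixLength-≤ (length u₀) e (exponents μ) ℕ.≤-refl) (cong (λ n → Maybe.map suc (prefixLength n (exponents μ))) (ℕ.n∸n≡0 e))) ⟨
    splitCount u (blockwiseCount w′) ((i , j , e) ∷ μ) (prefixLength (length u) (exponents ((i , j , e) ∷ μ))) ∎
    where
    first : List (ℙ m) → ℕ
    first s = optionCount nothing s (replicate e (i , j))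
  ... | tri> _ _ u<e = begin
    optionCount nothing (take e (u ++ w′)) (replicate e (i , j)) * blockwiseCount (drop e (u ++ w′)) μ
      ≡⟨ cong (_* blockwiseCount (drop e (u ++ w′)) μ) (overlong-count x u₀ w′ c (i , j) e u<e colours offColour) ⟩
    0
      ≡⟨ cong (splitCount u (blockwiseCount w′) ((i , j , e) ∷ μ)) (prefixLength-> (length u₀) e (exponents μ) (ℕ.<⇒≱ u<e)) ⟨
    splitCount u (blockwiseCount w′) ((i , j , e) ∷ μ) (prefixLength (length u) (exponents ((i , j , e) ∷ μ))) ∎

-- Refinement, partial sums and peaks

psums : ℕ → List ℕ → List ℕ
psums c [] = []
psums c (g ∷ γ) = (c + g) ∷ psums (c + g) γ

Positive : List ℕ → Set
Positive = All (1 ≤_)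

eat-< : ∀ {r g} as γ → g < r → eat r as (g ∷ γ) ≡ eat (r ∸ g) as γ
eat-< {r} {g} as γ g<r = cong (λ b → if b then eat (r ∸ g) as γ else (if g ≡ᵇ r then refines as γ else false)) (dec-true (g ℕ.<? r) g<r)

eat-≡ : ∀ {r g} as γ → g ≡ r → eat r as (g ∷ γ) ≡ refines as γ
eat-≡ {r} {g} as γ refl = trans (cong (λ b → if b then eat (r ∸ g) as γ else (if g ≡ᵇ r then refines as γ else false)) (dec-false (g ℕ.<? r) (ℕ.<-irrefl refl)))
                                (cong (λ b → if b then refines as γ else false) (dec-true (g ℕ.≟ r) refl))

eat-> : ∀ {r g} as γ → r < g → eat r as (g ∷ γ) ≡ false
eat-> {r} {g} as γ r<g = trans (cong (λ b → if b then eat (r ∸ g) as γ else (if g ≡ᵇ r then refines as γ else false)) (dec-false (g ℕ.<? r) (ℕ.<-asym r<g)))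
                               (cong (λ b → if b then refines as γ else false) (dec-false (g ℕ.≟ r) (ℕ.>⇒≢ r<g)))

above-head : ∀ t T → Linked _<_ (t ∷ T) → All (t <_) T
above-head t [] _ = []
above-head t (t′ ∷ T) (t<t′ ∷ linked) = t<t′ ∷ All.map (ℕ.<-trans t<t′) (above-head t′ T linked)

EndsAt : ℕ → List ℕ → ℕ → Set
EndsAt t [] N = t ≡ N
EndsAt t (t′ ∷ T) N = EndsAt t′ T N

private
  psums-above : ∀ d γ → Positive γ → ∀ {x} → x ∈ psums d γ → d < x
  psums-above d (g ∷ γ) (g≥1 ∷ _) (here refl) = ℕ.m<m+n d g≥1
  psums-above d (g ∷ γ) (g≥1 ∷ pos) (there x∈) = ℕ.<-trans (ℕ.m<m+n d g≥1) (psums-above (d + g) γ pos x∈)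

  ∈-psums-tail : ∀ c g γ {x} → c + g < x → x ∈ psums c (g ∷ γ) → x ∈ psums (c + g) γ
  ∈-psums-tail c g γ lt (here refl) = ⊥-elim (ℕ.<-irrefl refl lt)
  ∈-psums-tail c g γ lt (there x∈) = x∈

  positive-sum-zero : ∀ γ → Positive γ → sum γ ≡ 0 → γ ≡ []
  positive-sum-zero [] _ _ = refl
  positive-sum-zero (zero ∷ γ) (() ∷ _) _

  +-∸-cancel : ∀ {c t} → c < t → c + (t ∸ c) ≡ t
  +-∸-cancel c<t = ℕ.m+[n∸m]≡n (ℕ.<⇒≤ c<t)

  endsAt-shift : ∀ t T {c g s} → EndsAt t T (c + (g + s)) → EndsAt t T (c + g + s)
  endsAt-shift t T {c} {g} {s} = subst (EndsAt t T) (sym (ℕ.+-assoc c g s))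

-- Refinement, read off the partial sums: eat succeeds exactly when every target
-- position t ∷ T is a partial sum of γ.
eat⇒⊆psums : ∀ c t T γ → c < t → Linked _<_ (t ∷ T) → Positive γ →
             eat (t ∸ c) (diffs t T) γ ≡ true → All (_∈ psums c γ) (t ∷ T)
eat⇒⊆psums c t T [] _ _ _ ()
eat⇒⊆psums c t T (g ∷ γ) c<t linked (_ ∷ pos) eats with ℕ.<-cmp g (t ∸ c)
... | tri< g<r _ _ = All.map there (eat⇒⊆psums (c + g) t T γ c+g<t linked pos
                       (trans (cong (λ r → eat r (diffs t T) γ) (sym (ℕ.∸-+-assoc t c g))) (trans (sym (eat-< (diffs t T) γ g<r)) eats)))
  where
  c+g<t : c + g < t
  c+g<t = subst (c + g <_) (+-∸-cancel c<t) (ℕ.+-monoʳ-< c g<r)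
... | tri≈ _ g≡r _ = here (sym c+g≡t) ∷ later T linked (trans (sym (eat-≡ (diffs t T) γ g≡r)) eats)
  where
  c+g≡t : c + g ≡ t
  c+g≡t = trans (cong (c +_) g≡r) (+-∸-cancel c<t)
  later : ∀ T → Linked _<_ (t ∷ T) → refines (diffs t T) γ ≡ true → All (_∈ psums c (g ∷ γ)) T
  later [] _ _ = []
  later (t′ ∷ T′) (t<t′ ∷ linked′) refines′ =
    All.map there (subst (λ d → All (_∈ psums d γ) (t′ ∷ T′)) (sym c+g≡t) (eat⇒⊆psums t t′ T′ γ t<t′ linked′ pos refines′))
... | tri> _ _ r<g with trans (sym (eat-> (diffs t T) γ r<g)) eats
...   | ()

⊆psums⇒eat : ∀ c t T γ → c < t → Linked _<_ (t ∷ T) → Positive γ → EndsAt t T (c + sum γ) →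
             All (_∈ psums c γ) (t ∷ T) → eat (t ∸ c) (diffs t T) γ ≡ true
⊆psums⇒eat c t T [] _ _ _ _ (() ∷ _)
⊆psums⇒eat c t T (g ∷ γ) c<t linked (_ ∷ pos) ends (t∈ ∷ T⊆) with ℕ.<-cmp g (t ∸ c)
... | tri< g<r _ _ =
  trans (eat-< (diffs t T) γ g<r)
        (trans (cong (λ r → eat r (diffs t T) γ) (ℕ.∸-+-assoc t c g))
               (⊆psums⇒eat (c + g) t T γ c+g<t linked pos (endsAt-shift t T {c} {g} {sum γ} ends)
                  (∈-psums-tail c g γ c+g<t t∈ ∷ All.zipWith (λ (t<x , x∈) → ∈-psums-tail c g γ (ℕ.<-trans c+g<t t<x) x∈)
                                                            (above-head t T linked , T⊆))))
  where
  c+g<t : c + g < t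
  c+g<t = subst (c + g <_) (+-∸-cancel c<t) (ℕ.+-monoʳ-< c g<r)
... | tri≈ _ g≡r _ = trans (eat-≡ (diffs t T) γ g≡r) (later T linked ends T⊆)
  where
  c+g≡t : c + g ≡ t
  c+g≡t = trans (cong (c +_) g≡r) (+-∸-cancel c<t)
  ends′ : ∀ {t′} T′ → EndsAt t′ T′ (c + (g + sum γ)) → EndsAt t′ T′ (t + sum γ)
  ends′ T′ = subst (EndsAt _ T′) (trans (sym (ℕ.+-assoc c g (sum γ))) (cong (_+ sum γ) c+g≡t))
  later : ∀ T → Linked _<_ (t ∷ T) → EndsAt t T (c + (g + sum γ)) → All (_∈ psums c (g ∷ γ)) T → refines (diffs t T) γ ≡ true
  later [] _ t≡end _ with positive-sum-zero γ pos (ℕ.+-cancelˡ-≡ t (sum γ) 0 (trans (sym (ends′ [] t≡end)) (sym (ℕ.+-identityʳ t))))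
  ... | refl = refl
  later (t′ ∷ T′) linked′@(t<t′ ∷ linked″) ends″ T′⊆ =
    ⊆psums⇒eat t t′ T′ γ t<t′ linked″ pos (ends′ T′ ends″)
      (subst (λ d → All (_∈ psums d γ) (t′ ∷ T′)) c+g≡t
             (All.zipWith (λ (t<x , x∈) → ∈-psums-tail c g γ (subst (_< _) (sym c+g≡t) t<x) x∈) (above-head t (t′ ∷ T′) linked′ , T′⊆)))
... | tri> _ _ r<g = ⊥-elim (notInPsums t∈)
  where
  t<c+g : t < c + g
  t<c+g = subst (_< c + g) (+-∸-cancel c<t) (ℕ.+-monoʳ-< c r<g)
  notInPsums : t ∉ psums c (g ∷ γ)
  notInPsums (here t≡c+g) = ℕ.<-irrefl t≡c+g t<c+g
  notInPsums (there t∈′) = ℕ.<-asym t<c+g (psums-above (c + g) γ pos t∈′)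

psums-shift : ∀ b c X → psums (b + c) X ≡ map (b +_) (psums c X)
psums-shift b c [] = refl
psums-shift b c (g ∷ X) = cong₂ _∷_ (ℕ.+-assoc b c g)
  (trans (cong (λ z → psums z X) (ℕ.+-assoc b c g)) (psums-shift b (c + g) X))

starSums : List ℕ → List ℕ
starSums β = psums 0 (star β)

private
  -- Splitting a part b₂ ≥ 2 into (1 , b₂ - 1) adds exactly the partial sum b + 1.
  splitSums : ∀ b b₂ β → 1 ≤ b₂ → ∀ {p} →
    (p ∈ psums b (concatMap splitPart (b₂ ∷ β)) → p ∈ (b + 1) ∷ map (b +_) (starSums (b₂ ∷ β)))
    × (p ∈ (b + 1) ∷ map (b +_) (starSums (b₂ ∷ β)) → p ∈ psums b (concatMap splitPart (b₂ ∷ β)))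
  splitSums b 1 β _ {p} = there ∘′ subst (p ∈_) shifted , λ { (here refl) → here refl ; (there p∈) → subst (p ∈_) (sym shifted) p∈ }
    where
    shifted : psums b (concatMap splitPart (1 ∷ β)) ≡ map (b +_) (starSums (1 ∷ β))
    shifted = trans (cong (λ z → psums z (1 ∷ concatMap splitPart β)) (sym (ℕ.+-identityʳ b))) (psums-shift b 0 (1 ∷ concatMap splitPart β))
  splitSums b (suc (suc k)) β _ {p} = (λ { (here refl) → here refl ; (there p∈) → there (subst (p ∈_) shifted p∈) })
                                    , λ { (here refl) → here refl ; (there p∈) → there (subst (p ∈_) (sym shifted) p∈) }
    where
    X = concatMap splitPart β
    shifted : psums (b + 1) (suc k ∷ X) ≡ map (b +_) (starSums (suc (suc k) ∷ β))
    shifted = cong₂ _∷_ (ℕ.+-assoc b 1 (suc k))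
                        (trans (cong (λ z → psums z X) (ℕ.+-assoc b 1 (suc k))) (psums-shift b (suc (suc k)) X))

∈-starSums⁻ : ∀ b β → Positive β → ∀ {p} → p ∈ starSums (b ∷ β) →
              p ≡ b ⊎ (β ≢ [] × (p ≡ b + 1 ⊎ ∃ λ q → q ∈ starSums β × p ≡ b + q))
∈-starSums⁻ b β _ (here refl) = inj₁ refl
∈-starSums⁻ b (b₂ ∷ β) (b₂≥1 ∷ _) (there p∈) with proj₁ (splitSums b b₂ β b₂≥1) p∈
... | here refl = inj₂ ((λ ()) , inj₁ refl)
... | there p∈′ with ∈-map⁻ (b +_) p∈′
...   | q , q∈ , refl = inj₂ ((λ ()) , inj₂ (q , q∈ , refl))

starSums-≥ : ∀ b β → Positive β → ∀ {p} → p ∈ starSums (b ∷ β) → b ≤ p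
starSums-≥ b β pos p∈ with ∈-starSums⁻ b β pos p∈
... | inj₁ refl = ℕ.≤-refl
... | inj₂ (_ , inj₁ refl) = ℕ.m≤m+n b 1
... | inj₂ (_ , inj₂ (q , _ , refl)) = ℕ.m≤m+n b q

∈-starSums-beyond : ∀ b β → Positive β → ∀ {p} → p ∈ starSums (b ∷ β) → b + 1 < p → ∃ λ q → q ∈ starSums β × p ≡ b + q
∈-starSums-beyond b β pos p∈ b+1<p with ∈-starSums⁻ b β pos p∈
... | inj₁ refl = ⊥-elim (ℕ.<-asym (ℕ.m<m+n b (s≤s z≤n)) b+1<p)
... | inj₂ (_ , inj₁ refl) = ⊥-elim (ℕ.<-irrefl refl b+1<p)
... | inj₂ (_ , inj₂ q∈) = q∈

first∈starSums : ∀ b β → b ∈ starSums (b ∷ β)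
first∈starSums b β = here refl

second∈starSums : ∀ b β → Positive β → β ≢ [] → b + 1 ∈ starSums (b ∷ β)
second∈starSums b [] _ β≢[] = ⊥-elim (β≢[] refl)
second∈starSums b (b₂ ∷ β) (b₂≥1 ∷ _) _ = there (proj₂ (splitSums b b₂ β b₂≥1) (here refl))

shift∈starSums : ∀ b β → Positive β → ∀ {q} → q ∈ starSums β → b + q ∈ starSums (b ∷ β)
shift∈starSums b (b₂ ∷ β) (b₂≥1 ∷ _) q∈ = there (proj₂ (splitSums b b₂ β b₂≥1) (there (∈-map⁺ (b +_) q∈)))

∧-elimˡ : ∀ {x y} → x ∧ y ≡ true → x ≡ true
∧-elimˡ {true} _ = refl

∧-intro : ∀ {x y} → x ≡ true → y ≡ true → x ∧ y ≡ true
∧-intro refl refl = refl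

∧-elimʳ : ∀ {x y} → x ∧ y ≡ true → y ≡ true
∧-elimʳ {true} y≡ = y≡

module _ {m : ℕ} where

  -- The letters at 0-based positions k, k + 1, k + 2 of u form a peak, i.e. u has
  -- a peak at the 1-based position k + 2.
  peakAt : List (ℙ m) → ℕ → Bool
  peakAt (a ∷ b ∷ c ∷ r) zero = ltℙ a b ∧ ltℙ c b
  peakAt (a ∷ b ∷ c ∷ r) (suc k) = peakAt (b ∷ c ∷ r) k
  peakAt _ _ = false

  peakAt-suc : ∀ a r k → peakAt (a ∷ r) (suc k) ≡ peakAt r k
  peakAt-suc a [] k = refl
  peakAt-suc a (b ∷ []) k = refl
  peakAt-suc a (b ∷ c ∷ r) k = refl

  peakAt⇒< : ∀ u k → peakAt u k ≡ true → k + 3 ≤ length u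
  peakAt⇒< (a ∷ b ∷ c ∷ r) zero _ = s≤s (s≤s (s≤s z≤n))
  peakAt⇒< (a ∷ b ∷ c ∷ r) (suc k) peak = s≤s (peakAt⇒< (b ∷ c ∷ r) k peak)

  peakAt-++ʳ : ∀ s u k → peakAt (s ++ u) (length s + k) ≡ peakAt u k
  peakAt-++ʳ [] u k = refl
  peakAt-++ʳ (a ∷ s) u k = trans (peakAt-suc a (s ++ u) (length s + k)) (peakAt-++ʳ s u k)

  peakAt-++ˡ : ∀ s u k → k + 3 ≤ length s → peakAt (s ++ u) k ≡ peakAt s k
  peakAt-++ˡ (a ∷ b ∷ c ∷ s) u zero _ = refl
  peakAt-++ˡ (a ∷ []) u zero (s≤s ())
  peakAt-++ˡ (a ∷ b ∷ []) u zero (s≤s (s≤s ()))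
  peakAt-++ˡ (a ∷ s) u (suc k) (s≤s k+3≤s) =
    trans (peakAt-suc a (s ++ u) k) (trans (peakAt-++ˡ s u k k+3≤s) (sym (peakAt-suc a s k)))

  peakFree⇒¬peakAt : ∀ s → peakFree s ≡ true → ∀ k → peakAt s k ≡ false
  peakFree⇒¬peakAt (a ∷ b ∷ c ∷ r) free zero with ltℙ a b ∧ ltℙ c b
  ... | false = refl
  peakFree⇒¬peakAt (a ∷ b ∷ c ∷ r) () zero | true
  peakFree⇒¬peakAt (a ∷ b ∷ c ∷ r) free (suc k) = peakFree⇒¬peakAt (b ∷ c ∷ r) (∧-elimʳ free) k
  peakFree⇒¬peakAt [] _ k = refl
  peakFree⇒¬peakAt (a ∷ []) _ k = refl
  peakFree⇒¬peakAt (a ∷ b ∷ []) _ k = refl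

  ¬peakAt⇒peakFree : ∀ s → (∀ k → peakAt s k ≡ false) → peakFree s ≡ true
  ¬peakAt⇒peakFree (a ∷ b ∷ c ∷ r) noPeak =
    trans (cong (λ z → not z ∧ peakFree (b ∷ c ∷ r)) (noPeak zero)) (¬peakAt⇒peakFree (b ∷ c ∷ r) λ k → noPeak (suc k))
  ¬peakAt⇒peakFree [] _ = refl
  ¬peakAt⇒peakFree (a ∷ []) _ = refl
  ¬peakAt⇒peakFree (a ∷ b ∷ []) _ = refl

  private
    ∈-if⁻ : ∀ {b : Bool} {p i : ℕ} → p ∈ (if b then i ∷ [] else []) → b ≡ true × p ≡ i
    ∈-if⁻ {true} (here p≡i) = refl , p≡i

  ∈-peaksFrom⁻ : ∀ i (u : List (ℙ m)) {p} → p ∈ peaksFrom i u → ∃ λ k → p ≡ i + k × peakAt u k ≡ true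
  ∈-peaksFrom⁻ i (a ∷ b ∷ c ∷ r) {p} p∈ =
    step (∈-++⁻ (if ltℙ a b ∧ ltℙ c b then i ∷ [] else []) p∈) (∈-peaksFrom⁻ (suc i) (b ∷ c ∷ r))
    where
    step : p ∈ (if ltℙ a b ∧ ltℙ c b then i ∷ [] else []) ⊎ p ∈ peaksFrom (suc i) (b ∷ c ∷ r) →
           (p ∈ peaksFrom (suc i) (b ∷ c ∷ r) → ∃ λ k → p ≡ suc i + k × peakAt (b ∷ c ∷ r) k ≡ true) →
           ∃ λ k → p ≡ i + k × peakAt (a ∷ b ∷ c ∷ r) k ≡ true
    step (inj₁ here′) _ with ∈-if⁻ {ltℙ a b ∧ ltℙ c b} here′
    ... | peak , refl = 0 , sym (ℕ.+-identityʳ i) , peak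
    step (inj₂ later) ih with ih later
    ... | k , refl , peak = suc k , sym (ℕ.+-suc i k) , peak

  ∈-peaksFrom⁺ : ∀ i (u : List (ℙ m)) k → peakAt u k ≡ true → i + k ∈ peaksFrom i u
  ∈-peaksFrom⁺ i (a ∷ b ∷ c ∷ r) zero peak rewrite peak = here (ℕ.+-identityʳ i)
  ∈-peaksFrom⁺ i (a ∷ b ∷ c ∷ r) (suc k) peak =
    ∈-++⁺ʳ (if ltℙ a b ∧ ltℙ c b then i ∷ [] else [])
           (subst (_∈ peaksFrom (suc i) (b ∷ c ∷ r)) (sym (ℕ.+-suc i k)) (∈-peaksFrom⁺ (suc i) (b ∷ c ∷ r) k peak))

  peaksFrom-increasing : ∀ i (u : List (ℙ m)) → Linked _<_ (peaksFrom i u) × All (i ≤_) (peaksFrom i u)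
  peaksFrom-increasing i (a ∷ b ∷ c ∷ r) with peaksFrom-increasing (suc i) (b ∷ c ∷ r) | ltℙ a b ∧ ltℙ c b
  ... | linked , above | true = cons linked above , ℕ.≤-refl ∷ All.map ℕ.<⇒≤ above
    where
    cons : ∀ {L} → Linked _<_ L → All (suc i ≤_) L → Linked _<_ (i ∷ L)
    cons [] [] = [-]
    cons [-] (i<p ∷ _) = i<p ∷ [-]
    cons (p<q ∷ linked′) (i<p ∷ _) = i<p ∷ p<q ∷ linked′
  ... | linked , above | false = linked , All.map ℕ.<⇒≤ above
  peaksFrom-increasing i [] = [] , []
  peaksFrom-increasing i (a ∷ []) = [] , []
  peaksFrom-increasing i (a ∷ b ∷ []) = [] , []

  private
    rest-sum : ∀ (u : List (ℙ m)) b β → sum (b ∷ β) ≡ length u → sum β ≡ length (drop b u)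
    rest-sum u b β sum≡ = trans (sym (ℕ.m+n∸m≡n b (sum β))) (trans (cong (_∸ b) sum≡) (sym (length-drop b u)))

    first-fits : ∀ (u : List (ℙ m)) b β → sum (b ∷ β) ≡ length u → b ≤ length u
    first-fits u b β sum≡ = subst (b ≤_) sum≡ (ℕ.m≤m+n b (sum β))

    peakAt-first : ∀ (u : List (ℙ m)) b k → b ≤ length u → k + 3 ≤ b → peakAt u k ≡ peakAt (take b u) k
    peakAt-first u b k b≤u k+3≤b =
      trans (cong (λ z → peakAt z k) (sym (take++drop≡id b u)))
            (peakAt-++ˡ (take b u) (drop b u) k (subst (k + 3 ≤_) (sym (length-take-≤ b u b≤u)) k+3≤b))

    peakAt-rest : ∀ (u : List (ℙ m)) b k → b ≤ length u → peakAt u (b + k) ≡ peakAt (drop b u) k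
    peakAt-rest u b k b≤u =
      trans (cong₂ (λ z i → peakAt z (i + k)) (sym (take++drop≡id b u)) (sym (length-take-≤ b u b≤u)))
            (peakAt-++ʳ (take b u) (drop b u) k)

    peakPosition : ∀ k b → k + 3 ≤ b ⊎ (2 + k ≡ b ⊎ (2 + k ≡ b + 1 ⊎ ∃ λ k′ → k ≡ b + k′))
    peakPosition k zero = inj₂ (inj₂ (inj₂ (k , refl)))
    peakPosition zero (suc zero) = inj₂ (inj₂ (inj₁ refl))
    peakPosition zero (suc (suc zero)) = inj₂ (inj₁ refl)
    peakPosition zero (suc (suc (suc b))) = inj₁ (s≤s (s≤s (s≤s z≤n)))
    peakPosition (suc k) (suc b) with peakPosition k b
    ... | inj₁ k+3≤b = inj₁ (s≤s k+3≤b)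
    ... | inj₂ (inj₁ eq) = inj₂ (inj₁ (cong suc eq))
    ... | inj₂ (inj₂ (inj₁ eq)) = inj₂ (inj₂ (inj₁ (cong suc eq)))
    ... | inj₂ (inj₂ (inj₂ (k′ , eq))) = inj₂ (inj₂ (inj₂ (k′ , cong suc eq)))

    2+[b+k]≡b+[2+k] : ∀ b k → 2 + (b + k) ≡ b + (2 + k)
    2+[b+k]≡b+[2+k] b k = sym (trans (ℕ.+-suc b (suc k)) (cong suc (ℕ.+-suc b k)))

  peakFreeBlocks⇒peaks∈starSums : ∀ (u : List (ℙ m)) β → Positive β → sum β ≡ length u → peakFreeBlocks u β ≡ true →
                                  ∀ k → peakAt u k ≡ true → 2 + k ∈ starSums β
  peakFreeBlocks⇒peaks∈starSums [] [] _ _ _ k ()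
  peakFreeBlocks⇒peaks∈starSums (_ ∷ _) [] _ () _ _ _
  peakFreeBlocks⇒peaks∈starSums u (b ∷ β) (_ ∷ pos) sum≡ free k peak with peakPosition k b
  ... | inj₁ k+3≤b = ⊥-elim (false≢true (trans (sym (peakFree⇒¬peakAt (take b u) (∧-elimˡ free) k))
                                               (trans (sym (peakAt-first u b k (first-fits u b β sum≡) k+3≤b)) peak)))
  ... | inj₂ (inj₁ 2+k≡b) = subst (_∈ starSums (b ∷ β)) (sym 2+k≡b) (first∈starSums b β)
  ... | inj₂ (inj₂ (inj₁ 2+k≡b+1)) = subst (_∈ starSums (b ∷ β)) (sym 2+k≡b+1) (second∈starSums b β pos β≢[])
    where
    β≢[] : β ≢ []
    β≢[] refl = ℕ.1+n≰n (ℕ.≤-trans (ℕ.n≤1+n (suc k)) (ℕ.≤-pred (subst₂ _≤_ (ℕ.+-comm k 3) u≡1+k (peakAt⇒< u k peak))))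
      where
      u≡1+k : length u ≡ suc k
      u≡1+k = trans (sym sum≡) (trans (ℕ.+-comm b 0) (ℕ.suc-injective (trans (ℕ.+-comm 1 b) (sym 2+k≡b+1))))
  ... | inj₂ (inj₂ (inj₂ (k′ , refl))) =
    subst (_∈ starSums (b ∷ β)) (sym (2+[b+k]≡b+[2+k] b k′))
      (shift∈starSums b β pos (peakFreeBlocks⇒peaks∈starSums (drop b u) β pos (rest-sum u b β sum≡) (∧-elimʳ free) k′
        (trans (sym (peakAt-rest u b k′ (first-fits u b β sum≡))) peak)))

  peaks∈starSums⇒peakFreeBlocks : ∀ (u : List (ℙ m)) β → Positive β → sum β ≡ length u →
                                  (∀ k → peakAt u k ≡ true → 2 + k ∈ starSums β) → peakFreeBlocks u β ≡ true
  peaks∈starSums⇒peakFreeBlocks [] [] _ _ _ = refl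
  peaks∈starSums⇒peakFreeBlocks (_ ∷ _) [] _ () _
  peaks∈starSums⇒peakFreeBlocks u (b ∷ β) (_ ∷ pos) sum≡ peaks∈ =
    ∧-intro (¬peakAt⇒peakFree (take b u) noInnerPeak)
            (peaks∈starSums⇒peakFreeBlocks (drop b u) β pos (rest-sum u b β sum≡) laterPeaks∈)
    where
    b≤u : b ≤ length u
    b≤u = first-fits u b β sum≡
    noInnerPeak : ∀ k → peakAt (take b u) k ≡ false
    noInnerPeak k with peakAt (take b u) k in peak
    ... | false = refl
    ... | true = ⊥-elim (ℕ.<⇒≱ 2+k<b (starSums-≥ b β pos (peaks∈ k (trans (peakAt-first u b k b≤u k+3≤b) peak))))
      where
      k+3≤b : k + 3 ≤ b
      k+3≤b = subst (k + 3 ≤_) (length-take-≤ b u b≤u) (peakAt⇒< (take b u) k peak)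
      2+k<b : 2 + k < b
      2+k<b = subst (_≤ b) (ℕ.+-comm k 3) k+3≤b
    laterPeaks∈ : ∀ k′ → peakAt (drop b u) k′ ≡ true → 2 + k′ ∈ starSums β
    laterPeaks∈ k′ peak with ∈-starSums-beyond b β pos (peaks∈ (b + k′) (trans (peakAt-rest u b k′ b≤u) peak)) b+1<
      where
      b+1< : b + 1 < 2 + (b + k′)
      b+1< = subst (_< 2 + (b + k′)) (ℕ.+-comm 1 b) (s≤s (s≤s (ℕ.m≤m+n b k′)))
    ... | q , q∈ , 2+b+k′≡b+q =
      subst (_∈ starSums β) (sym (ℕ.+-cancelˡ-≡ b (2 + k′) q (trans (sym (2+[b+k]≡b+[2+k] b k′)) 2+b+k′≡b+q))) q∈

private
  splitPart-positive : ∀ b → 1 ≤ b → Positive (splitPart b)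
  splitPart-positive (suc zero) b≥1 = b≥1 ∷ []
  splitPart-positive (suc (suc k)) _ = s≤s z≤n ∷ s≤s z≤n ∷ []

  sum-splitPart : ∀ b → sum (splitPart b) ≡ b
  sum-splitPart zero = refl
  sum-splitPart (suc zero) = refl
  sum-splitPart (suc (suc k)) = cong (suc ∘′ suc) (ℕ.+-identityʳ k)

star-positive : ∀ β → Positive β → Positive (star β)
star-positive [] [] = []
star-positive (b ∷ β) (b≥1 ∷ pos) = b≥1 ∷ splitParts β pos
  where
  splitParts : ∀ β → Positive β → Positive (concatMap splitPart β)
  splitParts [] [] = []
  splitParts (b ∷ β) (b≥1 ∷ pos) = All.++⁺ (splitPart-positive b b≥1) (splitParts β pos)

sum-star : ∀ β → sum (star β) ≡ sum β
sum-star [] = refl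
sum-star (b ∷ β) = cong (b +_) (splitParts β)
  where
  splitParts : ∀ β → sum (concatMap splitPart β) ≡ sum β
  splitParts [] = refl
  splitParts (b ∷ β) = trans (sum-++ (splitPart b) (concatMap splitPart β)) (cong₂ _+_ (sum-splitPart b) (splitParts β))

sum∈psums : ∀ c γ → γ ≢ [] → c + sum γ ∈ psums c γ
sum∈psums c [] γ≢[] = ⊥-elim (γ≢[] refl)
sum∈psums c (g ∷ []) _ = here (cong (c +_) (ℕ.+-identityʳ g))
sum∈psums c (g ∷ g′ ∷ γ) _ = there (subst (_∈ psums (c + g) (g′ ∷ γ)) (ℕ.+-assoc c g _) (sum∈psums (c + g) (g′ ∷ γ) (λ ())))

private
  Linked-snoc : ∀ S N → Linked _<_ S → All (_< N) S → Linked _<_ (S ++ N ∷ [])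
  Linked-snoc [] N _ _ = [-]
  Linked-snoc (s ∷ []) N _ (s<N ∷ _) = s<N ∷ [-]
  Linked-snoc (s ∷ s′ ∷ S) N (s<s′ ∷ linked) (_ ∷ below) = s<s′ ∷ Linked-snoc (s′ ∷ S) N linked below

  endsAt-snoc : ∀ s S N → EndsAt s (S ++ N ∷ []) N
  endsAt-snoc s [] N = refl
  endsAt-snoc s (s′ ∷ S) N = endsAt-snoc s′ S N

refines-diffs⇒⊆psums : ∀ S N γ → Linked _<_ (S ++ N ∷ []) → All (0 <_) (S ++ N ∷ []) → Positive γ →
                       refines (diffs 0 (S ++ N ∷ [])) γ ≡ true → All (_∈ psums 0 γ) (S ++ N ∷ [])
refines-diffs⇒⊆psums [] N γ linked (N>0 ∷ _) pos = eat⇒⊆psums 0 N [] γ N>0 linked pos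
refines-diffs⇒⊆psums (s ∷ S) N γ linked (s>0 ∷ _) pos = eat⇒⊆psums 0 s (S ++ N ∷ []) γ s>0 linked pos

⊆psums⇒refines-diffs : ∀ S N γ → Linked _<_ (S ++ N ∷ []) → All (0 <_) (S ++ N ∷ []) → Positive γ → N ≡ sum γ →
                       All (_∈ psums 0 γ) (S ++ N ∷ []) → refines (diffs 0 (S ++ N ∷ [])) γ ≡ true
⊆psums⇒refines-diffs [] N γ linked (N>0 ∷ _) pos N≡ = ⊆psums⇒eat 0 N [] γ N>0 linked pos N≡
⊆psums⇒refines-diffs (s ∷ S) N γ linked (s>0 ∷ _) pos N≡ =
  ⊆psums⇒eat 0 s (S ++ N ∷ []) γ s>0 linked pos (subst (EndsAt s (S ++ N ∷ [])) N≡ (endsAt-snoc s S N))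

bool-ext : ∀ {a b : Bool} → (a ≡ true → b ≡ true) → (b ≡ true → a ≡ true) → a ≡ b
bool-ext {false} {false} _ _ = refl
bool-ext {false} {true} _ b⇒a = b⇒a refl
bool-ext {true} {false} a⇒b _ = sym (a⇒b refl)
bool-ext {true} {true} _ _ = refl

module _ {m : ℕ} where

  nonEmpty-length : ∀ (u : List (ℙ m)) → u ≢ [] → 0 < length u
  nonEmpty-length [] u≢[] = ⊥-elim (u≢[] refl)
  nonEmpty-length (_ ∷ _) _ = s≤s z≤n

  private
    peaks-bounded : ∀ (u : List (ℙ m)) → All (λ p → 0 < p × p < length u) (peakSet u)
    peaks-bounded u = All.tabulate λ p∈ → bounds (∈-peaksFrom⁻ 2 u p∈)
      where
      bounds : ∀ {p} → ∃ (λ k → p ≡ 2 + k × peakAt u k ≡ true) → 0 < p × p < length u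
      bounds (k , refl , peak) = s≤s z≤n , subst (_≤ length u) (ℕ.+-comm k 3) (peakAt⇒< u k peak)

    peaks-then-length : ∀ (u : List (ℙ m)) → Linked _<_ (peakSet u ++ length u ∷ [])
    peaks-then-length u = Linked-snoc (peakSet u) (length u) (proj₁ (peaksFrom-increasing 2 u)) (All.map proj₂ (peaks-bounded u))

  refines-peakComp-star : ∀ (u : List (ℙ m)) β → u ≢ [] → Positive β → sum β ≡ length u →
                          refines (peakComp u) (star β) ≡ peakFreeBlocks u β
  refines-peakComp-star u β u≢[] pos sum≡ = bool-ext ⇒free ⇐free
    where
    S : List ℕ
    S = peakSet u
    N : ℕ
    N = length u
    γ : List ℕ
    γ = star β
    N≡ : N ≡ sum γ
    N≡ = trans (sym sum≡) (sym (sum-star β))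
    N>0 : 0 < N
    N>0 = nonEmpty-length u u≢[]
    positions>0 : All (0 <_) (S ++ N ∷ [])
    positions>0 = All.++⁺ (All.map proj₁ (peaks-bounded u)) (N>0 ∷ [])
    ⇒free : refines (peakComp u) γ ≡ true → peakFreeBlocks u β ≡ true
    ⇒free refines′ = peaks∈starSums⇒peakFreeBlocks u β pos sum≡ λ k peak →
      All.lookup (All.++⁻ˡ S (refines-diffs⇒⊆psums S N γ (peaks-then-length u) positions>0 (star-positive β pos) refines′))
                 (∈-peaksFrom⁺ 2 u k peak)
    ⇐free : peakFreeBlocks u β ≡ true → refines (peakComp u) γ ≡ true
    ⇐free free = ⊆psums⇒refines-diffs S N γ (peaks-then-length u) positions>0 (star-positive β pos) N≡
      (All.++⁺ (All.tabulate λ p∈ → peak∈ (∈-peaksFrom⁻ 2 u p∈)) (subst (_∈ psums 0 γ) (sym N≡) (sum∈psums 0 γ γ≢[]) ∷ []))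
      where
      peak∈ : ∀ {p} → ∃ (λ k → p ≡ 2 + k × peakAt u k ≡ true) → p ∈ psums 0 γ
      peak∈ (k , refl , peak) = peakFreeBlocks⇒peaks∈starSums u β pos sum≡ free k peak
      γ≢[] : γ ≢ []
      γ≢[] γ≡[] = ℕ.<-irrefl (sym (trans N≡ (cong sum γ≡[]))) N>0

  private
    telescope : ∀ c S N → Linked _<_ (S ++ N ∷ []) → All (c ≤_) (S ++ N ∷ []) → sum (diffs c (S ++ N ∷ [])) ≡ N ∸ c
    telescope c [] N _ _ = ℕ.+-identityʳ (N ∸ c)
    telescope c (s ∷ S) N linked (c≤s ∷ _) = begin
      (s ∸ c) + sum (diffs s (S ++ N ∷ []))  ≡⟨ cong ((s ∸ c) +_) (telescope s S N (Linked.tail linked) (All.map ℕ.<⇒≤ (above-head s (S ++ N ∷ []) linked))) ⟩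
      (s ∸ c) + (N ∸ s)                      ≡⟨ ℕ.+-comm (s ∸ c) (N ∸ s) ⟩
      (N ∸ s) + (s ∸ c)                      ≡⟨ ℕ.+-∸-assoc (N ∸ s) c≤s ⟨
      (N ∸ s) + s ∸ c                        ≡⟨ cong (_∸ c) (ℕ.m∸n+n≡m s≤N) ⟩
      N ∸ c ∎
      where
      s≤N : s ≤ N
      s≤N = ℕ.<⇒≤ (All.lookup (above-head s (S ++ N ∷ []) linked) (∈-++⁺ʳ S (here refl)))

  sum-peakComp : ∀ (u : List (ℙ m)) → sum (peakComp u) ≡ length u
  sum-peakComp u = telescope 0 (peakSet u) (length u) (peaks-then-length u) (All.tabulate λ _ → z≤n)

-- Sums over compositions

module _ {A : Set} where

  Σ-cong : ∀ {f g : A → ℕ} xs → (∀ x → f x ≡ g x) → sum (map f xs) ≡ sum (map g xs)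
  Σ-cong xs f≗g = cong sum (map-cong f≗g xs)

  Σ-++ : ∀ (f : A → ℕ) xs ys → sum (map f (xs ++ ys)) ≡ sum (map f xs) + sum (map f ys)
  Σ-++ f xs ys = trans (cong sum (map-++ f xs ys)) (sum-++ (map f xs) (map f ys))

  Σ-*ˡ : ∀ c (f : A → ℕ) xs → sum (map (λ x → c * f x) xs) ≡ c * sum (map f xs)
  Σ-*ˡ c f [] = sym (ℕ.*-zeroʳ c)
  Σ-*ˡ c f (x ∷ xs) = trans (cong (c * f x +_) (Σ-*ˡ c f xs)) (sym (ℕ.*-distribˡ-+ c (f x) _))

  Σ-zero : ∀ (f : A → ℕ) xs → (∀ x → f x ≡ 0) → sum (map f xs) ≡ 0
  Σ-zero f [] _ = refl
  Σ-zero f (x ∷ xs) f≡0 = cong₂ _+_ (f≡0 x) (Σ-zero f xs f≡0)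

  Σ-filter : ∀ {P : A → Set} (P? : U.Decidable P) (f : A → ℕ) xs →
             sum (map f (filter P? xs)) ≡ sum (map (λ x → indicator (does (P? x)) * f x) xs)
  Σ-filter P? f [] = refl
  Σ-filter P? f (x ∷ xs) with does (P? x)
  ... | true = cong₂ _+_ (sym (ℕ.+-identityʳ (f x))) (Σ-filter P? f xs)
  ... | false = Σ-filter P? f xs

module _ {A B : Set} where

  Σ-map : ∀ (f : B → ℕ) (g : A → B) xs → sum (map f (map g xs)) ≡ sum (map (λ x → f (g x)) xs)
  Σ-map f g xs = cong sum (sym (map-∘ xs))

  Σ-concatMap : ∀ (f : B → ℕ) (h : A → List B) xs →
                sum (map f (concatMap h xs)) ≡ sum (map (λ x → sum (map f (h x))) xs)
  Σ-concatMap f h [] = refl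
  Σ-concatMap f h (x ∷ xs) = trans (Σ-++ f (h x) (concatMap h xs)) (cong (sum (map f (h x)) +_) (Σ-concatMap f h xs))

_≟ₗ_ : DecidableEquality (List ℕ)
_≟ₗ_ = List.≡-dec ℕ._≟_

isPrefix : List ℕ → List ℕ → Bool
isPrefix β X = does (β ≟ₗ take (length β) X)

private
  Σ-range1 : ∀ N e (G : ℕ → ℕ) → 1 ≤ e →
    sum (map (λ a → indicator (a ≡ᵇ e) * G a) (range1 N)) ≡ (if e ≤ᵇ N then G e else 0)
  Σ-range1 zero (suc e) G _ = refl
  Σ-range1 (suc N) e G e≥1 =
    trans (Σ-++ (λ a → indicator (a ≡ᵇ e) * G a) (range1 N) (suc N ∷ []))
          (trans (cong (_+ (indicator (suc N ≡ᵇ e) * G (suc N) + 0)) (Σ-range1 N e G e≥1)) lastTerm)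
    where
    lastTerm : (if e ≤ᵇ N then G e else 0) + (indicator (suc N ≡ᵇ e) * G (suc N) + 0) ≡ (if e ≤ᵇ suc N then G e else 0)
    lastTerm with ℕ.<-cmp e (suc N)
    ... | tri< e<N′ _ _ rewrite dec-true (e ℕ.≤? N) (ℕ.≤-pred e<N′) | dec-true (e ℕ.≤? suc N) (ℕ.<⇒≤ e<N′)
                            | dec-false (suc N ℕ.≟ e) (ℕ.>⇒≢ e<N′) = ℕ.+-identityʳ (G e)
    ... | tri≈ _ refl _ rewrite dec-false (suc N ℕ.≤? N) (ℕ.1+n≰n) | dec-true (suc N ℕ.≤? suc N) ℕ.≤-refl
                            | dec-true (suc N ℕ.≟ suc N) refl = trans (ℕ.+-identityʳ _) (ℕ.+-identityʳ (G (suc N)))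
    ... | tri> _ _ N′<e rewrite dec-false (e ℕ.≤? N) (ℕ.<⇒≱ (ℕ.<-trans (ℕ.n<1+n N) N′<e)) | dec-false (e ℕ.≤? suc N) (ℕ.<⇒≱ N′<e)
                            | dec-false (suc N ℕ.≟ e) (ℕ.<⇒≢ N′<e) = refl

prefixValue : (List ℕ → ℕ) → List ℕ → Maybe ℕ → ℕ
prefixValue Z X = maybe′ (λ k → Z (take k X)) 0

Σ-compositions : ∀ n X (Z : List ℕ → ℕ) → Positive X →
  sum (map (λ β → indicator (isPrefix β X) * Z β) (comps n)) ≡ prefixValue Z X (prefixLength n X)
Σ-compositions n X Z pos = fuelled n n X Z ℕ.≤-refl pos
  where
  term : List ℕ → (List ℕ → ℕ) → List ℕ → ℕ
  term X Z β = indicator (isPrefix β X) * Z β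
  fuelled : ∀ f n X (Z : List ℕ → ℕ) → n ≤ f → Positive X →
            sum (map (term X Z) (compsF f n)) ≡ prefixValue Z X (prefixLength n X)
  fuelled _ zero X Z _ _ = trans (ℕ.+-identityʳ (1 * Z [])) (ℕ.*-identityˡ (Z []))
  fuelled (suc f) (suc n) [] Z _ _ =
    trans (Σ-concatMap (term [] Z) (λ a → map (a ∷_) (compsF f (suc n ∸ a))) (range1 (suc n)))
          (Σ-zero _ (range1 (suc n)) λ a → trans (Σ-map (term [] Z) (a ∷_) (compsF f (suc n ∸ a)))
                                                  (Σ-zero _ (compsF f (suc n ∸ a)) λ _ → refl))
  fuelled (suc f) (suc n) (e ∷ X) Z (s≤s n≤f) (e≥1 ∷ pos) = begin
    sum (map (term (e ∷ X) Z) (concatMap (λ a → map (a ∷_) (compsF f (suc n ∸ a))) (range1 (suc n))))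
      ≡⟨ Σ-concatMap (term (e ∷ X) Z) (λ a → map (a ∷_) (compsF f (suc n ∸ a))) (range1 (suc n)) ⟩
    sum (map (λ a → sum (map (term (e ∷ X) Z) (map (a ∷_) (compsF f (suc n ∸ a))))) (range1 (suc n)))
      ≡⟨ Σ-cong (range1 (suc n)) firstPart ⟩
    sum (map (λ a → indicator (a ≡ᵇ e) * rest a) (range1 (suc n)))
      ≡⟨ Σ-range1 (suc n) e rest e≥1 ⟩
    (if e ≤ᵇ suc n then rest e else 0)
      ≡⟨ byCase (e ≤ᵇ suc n) ⟩
    prefixValue Z (e ∷ X) (prefixLength (suc n) (e ∷ X)) ∎
    where
    rest : ℕ → ℕ
    rest a = sum (map (term X (λ β → Z (a ∷ β))) (compsF f (suc n ∸ a)))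
    firstPart : ∀ a → sum (map (term (e ∷ X) Z) (map (a ∷_) (compsF f (suc n ∸ a)))) ≡ indicator (a ≡ᵇ e) * rest a
    firstPart a = begin
      sum (map (term (e ∷ X) Z) (map (a ∷_) (compsF f (suc n ∸ a))))
        ≡⟨ Σ-map (term (e ∷ X) Z) (a ∷_) (compsF f (suc n ∸ a)) ⟩
      sum (map (λ β → indicator ((a ≡ᵇ e) ∧ isPrefix β X) * Z (a ∷ β)) (compsF f (suc n ∸ a)))
        ≡⟨ Σ-cong (compsF f (suc n ∸ a)) (λ β → trans (cong (_* Z (a ∷ β)) (indicator-∧ (a ≡ᵇ e) (isPrefix β X)))
                                                      (ℕ.*-assoc (indicator (a ≡ᵇ e)) _ _)) ⟩
      sum (map (λ β → indicator (a ≡ᵇ e) * term X (λ β → Z (a ∷ β)) β) (compsF f (suc n ∸ a)))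
        ≡⟨ Σ-*ˡ (indicator (a ≡ᵇ e)) (term X (λ β → Z (a ∷ β))) (compsF f (suc n ∸ a)) ⟩
      indicator (a ≡ᵇ e) * rest a ∎
    byCase : ∀ b →
             (if b then rest e else 0) ≡ prefixValue Z (e ∷ X) (if b then Maybe.map suc (prefixLength (suc n ∸ e) X) else nothing)
    byCase false = refl
    byCase true = trans (fuelled f (suc n ∸ e) X (λ β → Z (e ∷ β)) (ℕ.≤-trans (ℕ.∸-monoʳ-≤ (suc n) e≥1) n≤f) pos)
                          (shifted (prefixLength (suc n ∸ e) X))
      where
      shifted : ∀ r → prefixValue (λ β → Z (e ∷ β)) X r ≡ prefixValue Z (e ∷ X) (Maybe.map suc r)
      shifted (just k) = refl
      shifted nothing = refl

-- The coefficients of K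

module _ {m : ℕ} where

  _≟ᶜ_ : DecidableEquality (CComp m)
  _≟ᶜ_ = List.≡-dec (Product.≡-dec Fin._≟_ ℕ._≟_)

  ChatList : List (ℙ m) → CComp m
  ChatList w = concatMap (λ b → colorParts (proj₁ b) (peakComp (proj₂ b))) (runs proj₂ w)

  labelRun : Fin m × List (ℙ m) → Fin m × CComp m
  labelRun (c , u) = c , colorParts c (peakComp u)

  private
    flatten-labelRun : ∀ B → flatten proj₁ (map labelRun B) ≡ concatMap (λ b → colorParts (proj₁ b) (peakComp (proj₂ b))) B
    flatten-labelRun [] = refl
    flatten-labelRun (b ∷ B) = cong (colorParts (proj₁ b) (peakComp (proj₂ b)) ++_) (flatten-labelRun B)

    colorParts-monochrome : ∀ (c : Fin m) xs → All (λ x → proj₁ x ≡ c) (colorParts c xs)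
    colorParts-monochrome c [] = []
    colorParts-monochrome c (x ∷ xs) = refl ∷ colorParts-monochrome c xs

    labelRun-isRainbow : ∀ B → IsRainbow proj₂ B → IsRainbow proj₁ (map labelRun B)
    labelRun-isRainbow B (mono , linked) = monochrome B mono , relabel B linked
      where
      diffs-nonEmpty : ∀ c S N → diffs c (S ++ N ∷ []) ≢ []
      diffs-nonEmpty c [] N ()
      diffs-nonEmpty c (_ ∷ _) N ()
      labels-nonEmpty : ∀ c (u : List (ℙ m)) → colorParts c (peakComp u) ≢ []
      labels-nonEmpty c u with peakComp u | diffs-nonEmpty 0 (peakSet u) (length u)
      ... | [] | nonEmpty = ⊥-elim (nonEmpty refl)
      ... | _ ∷ _ | _ = λ ()
      monochrome : ∀ B → All (Monochrome proj₂) B → All (Monochrome proj₁) (map labelRun B)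
      monochrome [] [] = []
      monochrome ((c , u) ∷ B) (_ ∷ mono′) = (labels-nonEmpty c u , colorParts-monochrome c (peakComp u)) ∷ monochrome B mono′
      relabel : ∀ B → Linked (λ b b′ → proj₁ b ≢ proj₁ b′) B → Linked (λ b b′ → proj₁ b ≢ proj₁ b′) (map labelRun B)
      relabel [] [] = []
      relabel (b ∷ []) [-] = [-]
      relabel (b ∷ b′ ∷ B) (b≢b′ ∷ linked′) = b≢b′ ∷ relabel (b′ ∷ B) linked′

  runs-Chat : ∀ w → runs proj₁ (ChatList w) ≡ map labelRun (runs proj₂ w)
  runs-Chat w = rainbow-unique proj₁ (runs proj₁ (ChatList w)) (map labelRun (runs proj₂ w))
                  (proj₁ (runs-isRainbow proj₁ (ChatList w))) (labelRun-isRainbow (runs proj₂ w) (proj₁ (runs-isRainbow proj₂ w)))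
                  (trans (proj₂ (runs-isRainbow proj₁ (ChatList w))) (sym (flatten-labelRun (runs proj₂ w))))

  Mcoef-++ : ∀ (γ₁ γ₂ : CComp m) μ →
    Mcoef (γ₁ ++ γ₂) μ ≡ indicator (does (typeOf (take (length γ₁) μ) ≟ᶜ γ₁)) * Mcoef γ₂ (drop (length γ₁) μ)
  Mcoef-++ γ₁ γ₂ μ with typeOf μ ≟ᶜ (γ₁ ++ γ₂) | typeOf (take (length γ₁) μ) ≟ᶜ γ₁ | typeOf (drop (length γ₁) μ) ≟ᶜ γ₂
  ... | yes _ | yes _ | yes _ = refl
  ... | yes μ≡ | no ≢₁ | _ = ⊥-elim (≢₁ (trans (sym (take-map (length γ₁) μ)) (trans (cong (take (length γ₁)) μ≡) (take-++-length γ₁ γ₂))))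
  ... | yes μ≡ | yes _ | no ≢₂ = ⊥-elim (≢₂ (trans (sym (drop-map (length γ₁) μ)) (trans (cong (drop (length γ₁)) μ≡) (drop-++-length γ₁ γ₂))))
  ... | no ≢ | yes ≡₁ | yes ≡₂ = ⊥-elim (≢ (trans (cong typeOf (sym (take++drop≡id (length γ₁) μ)))
                                             (trans (map-++ _ (take (length γ₁) μ) (drop (length γ₁) μ)) (cong₂ _++_ ≡₁ ≡₂))))
  ... | no _ | yes _ | no _ = refl
  ... | no _ | no _ | _ = refl

  Kterm : Monomial m → List (Fin m × List ℕ) → ℕ
  Kterm μ t = 2 ^ sum (map (λ b → length (proj₂ b)) t) * Mcoef (concatMap (λ b → colorParts (proj₁ b) (proj₂ b)) t) μ

  -- Kcoef α μ is by definition blockSum (runs proj₁ α) μ.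
  blockSum : List (Fin m × CComp m) → Monomial m → ℕ
  blockSum B μ = sum (map (Kterm μ) (sequenceL (map candidates B)))

  colouredParts : Fin m × List ℕ → CComp m
  colouredParts (c , β) = colorParts c β

  candidateWeight : Monomial m → Fin m × List ℕ → ℕ
  candidateWeight μ x = 2 ^ length (proj₂ x) * indicator (does (typeOf (take (length (colouredParts x)) μ) ≟ᶜ colouredParts x))

  blockSum-∷ : ∀ blk B μ → blockSum (blk ∷ B) μ
             ≡ sum (map (λ x → candidateWeight μ x * blockSum B (drop (length (colouredParts x)) μ)) (candidates blk))
  blockSum-∷ blk B μ = trans (Σ-concatMap (Kterm μ) (λ x → map (x ∷_) tuples) (candidates blk)) (Σ-cong (candidates blk) perCandidate)
    where
    tuples : List (List (Fin m × List ℕ))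
    tuples = sequenceL (map candidates B)
    perCandidate : ∀ x → sum (map (Kterm μ) (map (x ∷_) tuples)) ≡ candidateWeight μ x * blockSum B (drop (length (colouredParts x)) μ)
    perCandidate x = trans (Σ-map (Kterm μ) (x ∷_) tuples)
                     (trans (Σ-cong tuples perTuple) (Σ-*ˡ (candidateWeight μ x) (Kterm (drop (length (colouredParts x)) μ)) tuples))
      where
      perTuple : ∀ t → Kterm μ (x ∷ t) ≡ candidateWeight μ x * Kterm (drop (length (colouredParts x)) μ) t
      perTuple t = trans (cong₂ _*_ (ℕ.^-distribˡ-+-* 2 (length (proj₂ x)) (sum (map (λ b → length (proj₂ b)) t)))
                                    (Mcoef-++ (colouredParts x) (concatMap (λ b → colorParts (proj₁ b) (proj₂ b)) t) μ))
                         (interchange (2 ^ length (proj₂ x)) (2 ^ sum (map (λ b → length (proj₂ b)) t)) _ _)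
        where
        interchange : ∀ a b c d → a * b * (c * d) ≡ a * c * (b * d)
        interchange = solve-∀

module _ {m : ℕ} where

  map-proj₂-colorParts : ∀ (c : Fin m) xs → map proj₂ (colorParts c xs) ≡ xs
  map-proj₂-colorParts c [] = refl
  map-proj₂-colorParts c (x ∷ xs) = cong (x ∷_) (map-proj₂-colorParts c xs)

  private
    monochromeType⇒allFit : ∀ (ν : Monomial m) c → All (λ t → 1 ≤ proj₁ t) ν → typeOf ν ≡ colorParts c (exponents ν) → AllFit ν c
    monochromeType⇒allFit [] c _ _ = []
    monochromeType⇒allFit ((i , j , e) ∷ ν) c (i≥1 ∷ pos) eq with ∷-injective eq
    ... | j-c , eq′ = (i≥1 , cong proj₁ j-c) ∷ monochromeType⇒allFit ν c pos eq′

    allFit⇒monochromeType : ∀ (ν : Monomial m) c → AllFit ν c → typeOf ν ≡ colorParts c (exponents ν)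
    allFit⇒monochromeType [] c [] = refl
    allFit⇒monochromeType ((i , j , e) ∷ ν) c ((_ , refl) ∷ fit) = cong ((j , e) ∷_) (allFit⇒monochromeType ν c fit)

  monochromeType≡allFit : ∀ (ν : Monomial m) c → All (λ t → 1 ≤ proj₁ t) ν →
                          does (typeOf ν ≟ᶜ colorParts c (exponents ν)) ≡ does (allFit? ν c)
  monochromeType≡allFit ν c pos =
    does-≡ (typeOf ν ≟ᶜ colorParts c (exponents ν))
           (map′ (allFit⇒monochromeType ν c) (monochromeType⇒allFit ν c pos) (allFit? ν c))

  monochromeType⇒isPrefix : ∀ (μ : Monomial m) c β → typeOf (take (length β) μ) ≡ colorParts c β → β ≡ take (length β) (exponents μ)
  monochromeType⇒isPrefix μ c β eq = begin
    β                                      ≡⟨ map-proj₂-colorParts c β ⟨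
    map proj₂ (colorParts c β)             ≡⟨ cong (map proj₂) eq ⟨
    map proj₂ (typeOf (take (length β) μ)) ≡⟨ map-∘ (take (length β) μ) ⟨
    exponents (take (length β) μ)          ≡⟨ take-map (length β) μ ⟨
    take (length β) (exponents μ)          ∎

prefixLength-spec : ∀ n X k → prefixLength n X ≡ just k → k ≤ length X × sum (take k X) ≡ n
prefixLength-spec zero X .zero refl = z≤n , refl
prefixLength-spec (suc n) (e ∷ X) k eq with e Data.Nat.≤ᵇ suc n in e≤n | prefixLength (suc n ∸ e) X in rest
prefixLength-spec (suc n) (e ∷ X) .(suc k′) refl | true | just k′ with prefixLength-spec (suc n ∸ e) X k′ rest
... | k′≤X , sum≡ = s≤s k′≤X , trans (cong (e +_) sum≡) (ℕ.m+[n∸m]≡n (ℕ.≤ᵇ⇒≤ e (suc n) (subst Bool.T (sym e≤n) _)))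

module _ {m : ℕ} where

  private
    length-colorParts : ∀ (c : Fin m) xs → length (colorParts c xs) ≡ length xs
    length-colorParts c xs = length-map _ xs

    does-≟-true : ∀ b → does (b Bool.≟ true) ≡ b
    does-≟-true false = refl
    does-≟-true true = refl

    candidates-labelRun : ∀ (c : Fin m) xs →
      candidates (c , colorParts c xs) ≡ map (c ,_) (filter (λ β → refines xs (star β) Bool.≟ true) (comps (sum xs)))
    candidates-labelRun c xs rewrite map-proj₂-colorParts c xs = refl

  candidateWeight-nonPrefix : ∀ μ c β → β ≢ take (length β) (exponents μ) → candidateWeight μ (c , β) ≡ 0
  candidateWeight-nonPrefix μ c β notPrefix with typeOf (take (length (colorParts c β)) μ) ≟ᶜ colorParts c β
  ... | yes type≡ = ⊥-elim (notPrefix (monochromeType⇒isPrefix μ c β (subst (λ n → typeOf (take n μ) ≡ colorParts c β) (length-colorParts c β) type≡)))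
  ... | no _ = ℕ.*-zeroʳ (2 ^ length β)

  candidateWeight-prefix : ∀ μ c k → k ≤ length μ → All (λ t → 1 ≤ proj₁ t) μ →
                           candidateWeight μ (c , take k (exponents μ)) ≡ 2 ^ k * indicator (allFit (take k μ) c)
  candidateWeight-prefix μ c k k≤μ pos
    rewrite take-map {f = λ t → proj₂ (proj₂ t)} k μ | length-colorParts c (exponents (take k μ))
          | length-map (λ t → proj₂ (proj₂ t)) (take k μ) | length-take-≤ k μ k≤μ
          | monochromeType≡allFit (take k μ) c (All.take⁺ k pos) = refl

  firstRun-sum : ∀ (u : List (ℙ m)) c (F : Monomial m → ℕ) μ → u ≢ [] → All (λ y → proj₂ y ≡ c) u → AllPairs _≢_ u →
    Canonical μ →
    sum (map (λ x → candidateWeight μ x * F (drop (length (colouredParts x)) μ)) (candidates (labelRun (c , u))))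
    ≡ splitCount u F μ (prefixLength (length u) (exponents μ))
  firstRun-sum u c F μ u≢[] colours distinct canonical@(bounds , _) = begin
    sum (map h (candidates (c , colorParts c pc)))
      ≡⟨ cong (λ L → sum (map h L)) (candidates-labelRun c pc) ⟩
    sum (map h (map (c ,_) (filter P? (comps (sum pc)))))
      ≡⟨ Σ-map h (c ,_) (filter P? (comps (sum pc))) ⟩
    sum (map (λ β → h (c , β)) (filter P? (comps (sum pc))))
      ≡⟨ Σ-filter P? (λ β → h (c , β)) (comps (sum pc)) ⟩
    sum (map (λ β → indicator (does (P? β)) * h (c , β)) (comps (sum pc)))
      ≡⟨ Σ-cong (comps (sum pc)) onlyPrefixes ⟩
    sum (map (λ β → indicator (isPrefix β X) * Z β) (comps (sum pc)))
      ≡⟨ Σ-compositions (sum pc) X Z exponents-positive ⟩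
    prefixValue Z X (prefixLength (sum pc) X)
      ≡⟨ cong (λ n → prefixValue Z X (prefixLength n X)) (sum-peakComp u) ⟩
    prefixValue Z X (prefixLength (length u) X)
      ≡⟨ atPrefix (prefixLength (length u) X) refl ⟩
    splitCount u F μ (prefixLength (length u) X) ∎
    where
    pc : List ℕ
    pc = peakComp u
    X : List ℕ
    X = exponents μ
    h : Fin m × List ℕ → ℕ
    h x = candidateWeight μ x * F (drop (length (colouredParts x)) μ)
    P? : (β : List ℕ) → Dec (refines pc (star β) ≡ true)
    P? β = refines pc (star β) Bool.≟ true
    Z : List ℕ → ℕ
    Z β = indicator (refines pc (star β)) * h (c , β)
    positions : All (λ t → 1 ≤ proj₁ t) μ
    positions = All.map proj₁ bounds
    exponentsBounds : All (λ t → 1 ≤ proj₂ (proj₂ t)) μ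
    exponentsBounds = All.map proj₂ bounds
    exponents-positive : Positive X
    exponents-positive = All.map⁺ exponentsBounds
    onlyPrefixes : ∀ β → indicator (does (P? β)) * h (c , β) ≡ indicator (isPrefix β X) * Z β
    onlyPrefixes β with β ≟ₗ take (length β) X
    ... | yes _ = trans (cong (λ b → indicator b * h (c , β)) (does-≟-true (refines pc (star β)))) (sym (ℕ.*-identityˡ (Z β)))
    ... | no notPrefix = trans (cong (λ n → indicator (does (P? β)) * (n * F (drop (length (colorParts c β)) μ)))
                                     (candidateWeight-nonPrefix μ c β notPrefix))
                               (ℕ.*-zeroʳ (indicator (does (P? β))))
    prefixTerm : ∀ k → k ≤ length μ → sum (take k X) ≡ length u → Z (take k X) ≡ blockwiseCount u (take k μ) * F (drop k μ)
    prefixTerm k k≤μ sum≡ = begin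
      indicator (refines pc (star β)) * (candidateWeight μ (c , β) * F (drop (length (colorParts c β)) μ))
        ≡⟨ cong₂ (λ r n → indicator r * (candidateWeight μ (c , β) * F (drop n μ)))
                 (refines-peakComp-star u β u≢[] (All.take⁺ k exponents-positive) sum≡)
                 (trans (length-colorParts c β) (length-take-≤ k X (subst (k ≤_) (sym (length-map _ μ)) k≤μ))) ⟩
      indicator (peakFreeBlocks u β) * (candidateWeight μ (c , β) * F (drop k μ))
        ≡⟨ cong₂ (λ b n → indicator (peakFreeBlocks u b) * (n * F (drop k μ))) (take-map k μ) (candidateWeight-prefix μ c k k≤μ positions) ⟩
      indicator (peakFreeBlocks u (exponents ν)) * (2 ^ k * indicator (allFit ν c) * F (drop k μ))
        ≡⟨ rearrange (indicator (peakFreeBlocks u (exponents ν))) (2 ^ k) (indicator (allFit ν c)) (F (drop k μ)) ⟩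
      indicator (allFit ν c) * (2 ^ k * indicator (peakFreeBlocks u (exponents ν))) * F (drop k μ)
        ≡⟨ cong (λ l → indicator (allFit ν c) * (2 ^ l * indicator (peakFreeBlocks u (exponents ν))) * F (drop k μ)) (length-take-≤ k μ k≤μ) ⟨
      indicator (allFit ν c) * (2 ^ length ν * indicator (peakFreeBlocks u (exponents ν))) * F (drop k μ)
        ≡⟨ cong (_* F (drop k μ)) (monochrome-count u c ν colours distinct (All.take⁺ k exponentsBounds) (trans (cong sum (sym (take-map k μ))) sum≡)) ⟨
      blockwiseCount u ν * F (drop k μ) ∎
      where
      β : List ℕ
      β = take k X
      ν : Monomial m
      ν = take k μ
      rearrange : ∀ a b d f → a * (b * d * f) ≡ d * (b * a) * f
      rearrange = solve-∀
    atPrefix : ∀ r → prefixLength (length u) X ≡ r → prefixValue Z X r ≡ splitCount u F μ r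
    atPrefix nothing _ = refl
    atPrefix (just k) eq = prefixTerm k (subst (k ≤_) (length-map _ μ) (proj₁ spec)) (proj₂ spec)
      where
      spec : k ≤ length X × sum (take k X) ≡ length u
      spec = prefixLength-spec (length u) X k eq

module _ {m : ℕ} where

  canonical-drop : ∀ k (μ : Monomial m) → Canonical μ → Canonical (drop k μ)
  canonical-drop zero μ canonical = canonical
  canonical-drop (suc k) [] canonical = canonical
  canonical-drop (suc k) (t ∷ μ) canonical = canonical-drop k μ (canonical-tail canonical)

  blockSum≡blockwiseCount : ∀ B → IsRainbow proj₂ B → AllPairs _≢_ (flatten proj₂ B) → ∀ μ → Canonical μ →
                            blockSum (map labelRun B) μ ≡ blockwiseCount (flatten proj₂ B) μ
  blockSum≡blockwiseCount [] _ _ [] _ = refl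
  blockSum≡blockwiseCount [] _ _ ((i , j , suc e) ∷ μ) _ = refl
  blockSum≡blockwiseCount [] _ _ ((i , j , zero) ∷ μ) ((_ , ()) ∷ _ , _)
  blockSum≡blockwiseCount ((c , u) ∷ B) rainbow@((u≢[] , colours) ∷ _ , _) distinct μ canonical = begin
    blockSum (labelRun (c , u) ∷ map labelRun B) μ
      ≡⟨ blockSum-∷ (labelRun (c , u)) (map labelRun B) μ ⟩
    sum (map (λ x → candidateWeight μ x * blockSum (map labelRun B) (drop (length (colouredParts x)) μ)) (candidates (labelRun (c , u))))
      ≡⟨ Σ-cong (candidates (labelRun (c , u))) (λ x → cong (candidateWeight μ x *_)
           (blockSum≡blockwiseCount B (rainbow-tail proj₂ rainbow) distinctʳ (drop (length (colouredParts x)) μ)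
                                    (canonical-drop (length (colouredParts x)) μ canonical))) ⟩
    sum (map (λ x → candidateWeight μ x * blockwiseCount w′ (drop (length (colouredParts x)) μ)) (candidates (labelRun (c , u))))
      ≡⟨ firstRun-sum u c (blockwiseCount w′) μ u≢[] colours distinctˡ canonical ⟩
    splitCount u (blockwiseCount w′) μ (prefixLength (length u) (exponents μ))
      ≡⟨ blockwiseCount-++ u w′ μ c u≢[] colours (rainbow-startsOff proj₂ (c , u) B rainbow) ⟨
    blockwiseCount (u ++ w′) μ ∎
    where
    w′ : List (ℙ m)
    w′ = flatten proj₂ B
    distinctˡ : AllPairs _≢_ u
    distinctˡ = subst (AllPairs _≢_) (take-++-length u w′) (AllPairs.take⁺ (length u) distinct)
    distinctʳ : AllPairs _≢_ w′
    distinctʳ = subst (AllPairs _≢_) (drop-++-length u w′) (AllPairs.drop⁺ (length u) distinct)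

  Kcoef-Chat : ∀ (w : List (ℙ m)) → AllPairs _≢_ w → (μ : Monomial m) → Canonical μ → Kcoef (ChatList w) μ ≡ blockwiseCount w μ
  Kcoef-Chat w distinct μ canonical = begin
    blockSum (runs proj₁ (ChatList w)) μ            ≡⟨ cong (λ R → blockSum R μ) (runs-Chat w) ⟩
    blockSum (map labelRun (runs proj₂ w)) μ        ≡⟨ blockSum≡blockwiseCount (runs proj₂ w) rainbow (subst (AllPairs _≢_) (sym flat≡) distinct) μ canonical ⟩
    blockwiseCount (flatten proj₂ (runs proj₂ w)) μ ≡⟨ cong (λ v → blockwiseCount v μ) flat≡ ⟩
    blockwiseCount w μ ∎
    where
    rainbow : IsRainbow proj₂ (runs proj₂ w)
    rainbow = proj₁ (runs-isRainbow proj₂ w)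
    flat≡ : flatten proj₂ (runs proj₂ w) ≡ w
    flat≡ = proj₂ (runs-isRainbow proj₂ w)

word-injective : ∀ {m n} (σ : Permutation′ n) (c : Fin n → Fin m) {a b} → lookup (word σ c) a ≡ lookup (word σ c) b → a ≡ b
word-injective σ c {a} {b} eq = trans (sym (inverseˡ σ)) (trans (cong (σ ⟨$⟩ˡ_) σa≡σb) (inverseˡ σ))
  where
  σa≡σb : σ ⟨$⟩ʳ a ≡ σ ⟨$⟩ʳ b
  σa≡σb = Fin.toℕ-injective (ℕ.suc-injective (cong proj₁ (trans (sym (lookup∘tabulate _ a)) (trans eq (lookup∘tabulate _ b)))))

word-distinct : ∀ {m n} (σ : Permutation′ n) (c : Fin n → Fin m) → AllPairs _≢_ (toList (word σ c))
word-distinct σ c = AllPairs-toList⁺ (word σ c) λ a b a<b eq → ℕ.<-irrefl (cong toℕ (word-injective σ c eq)) a<b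

mainTheorem14 : (m : ℕ) → 1 ≤ m → (n : ℕ) (σ : Permutation′ n) (c : Fin n → Fin m)
    → (μ : Monomial m) → Canonical μ
    → HasCard (λ (f : Vec (ℙ± m) n) → IsEnriched (word σ c) f × WeightIs f μ)
              (Kcoef (Chat (word σ c)) μ)
mainTheorem14 m m≥1 n σ c μ canonical =
  subst (HasCard (λ f → IsEnriched (word σ c) f × WeightIs f μ))
        (trans (optionCount≡blockwiseCount w μ canonical) (sym (Kcoef-Chat w distinct μ canonical)))
        (enriched-hasCard (true , 1 , fromℕ< m≥1) (word σ c) distinct μ canonical)
  where
  w : List (ℙ m)
  w = toList (word σ c)
  distinct : AllPairs _≢_ w
  distinct = word-distinct σ c
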